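{- Let $L_n=\mathrm{LB}_n(111,1221)$. Then $L_0=L_1=1$ and, for $n\ge 2$, $$L_n=L_{n-1}+L_{n-2}+\sum_{k=1}^{n-2}q^k L_{k-1}L_{n-k-1}.$$
   Context: A restricted growth function (RGF) of length $n$ is a sequence $w=w_1\dots w_n$ of positive integers with $w_1=1$ and $w_i\le 1+\max\{w_1,\dots,w_{i-1}\}$ for $i\ge 2$; $R_0$ consists of the empty word and $R_n$ is the set of RGFs of length $n$. The standardization of a word replaces every occurrence of its smallest letter by $1$, of its next smallest letter by $2$, and so on. An RGF $w$ contains an RGF $v$ if some subword (subsequence, not necessarily consecutive) of $w$ standardizes to $v$; otherwise $w$ avoids $v$. $R_n(v_1,v_2)$ is the set of $w\in R_n$ avoiding both $v_1$ and $v_2$. For a word $w$ and position $j$, $\mathrm{lb}(w_j)$ is the number of distinct values $w_i$ with $i<j$ and $w_i>w_j$, $\mathrm{lb}(w)=\sum_j\mathrm{lb}(w_j)$, and $\mathrm{LB}_n(v_1,v_2)=\sum_{w\in R_n(v_1,v_2)}q^{\mathrm{lb}(w)}$. -}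

module Defs where

open import Data.Nat using (ℕ; zero; suc; _+_; _*_; _∸_; _≤ᵇ_; _<ᵇ_; _≡ᵇ_)
open import Data.Bool using (Bool; true; false; _∧_; _∨_; not; if_then_else_)
open import Data.List using (List; []; _∷_; map; filter; length; foldr; concatMap)
open import Data.Bool.ListAction using (any)
open import Data.Nat.ListAction using (sum)
open import Data.List.Base using (upTo)
import Data.Nat as ℕ
open import Data.Bool using (T?)
open import Relation.Binary.PropositionalEquality using (_≡_; _≗_)

-- Words are lists of natural numbers (letters are positive integers).

Word : Set
Word = List ℕ

_==_ : Word → Word → Bool
[]       == []       = true
(x ∷ xs) == (y ∷ ys) = (x ≡ᵇ y) ∧ (xs == ys)
_        == _        = false

elemᵇ : ℕ → List ℕ → Bool
elemᵇ x = any (λ y → x ≡ᵇ y)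

distinct : Word → List ℕ
distinct []       = []
distinct (x ∷ xs) = let d = distinct xs in if elemᵇ x d then d else x ∷ d

maxL : Word → ℕ
maxL = foldr ℕ._⊔_ 0

-- Restricted growth functions.
-- w₁ = 1 and wᵢ ≤ 1 + max{w₁,…,w_{i-1}};  (with max ∅ = 0 this
-- condition at i = 1 forces w₁ ≤ 1, and positivity gives w₁ = 1).

isRGFFrom : ℕ → Word → Bool      -- argument: max of the prefix so far
isRGFFrom m []       = true
isRGFFrom m (x ∷ xs) = (1 ≤ᵇ x) ∧ (x ≤ᵇ suc m) ∧ isRGFFrom (m ℕ.⊔ x) xs

isRGF : Word → Bool
isRGF = isRGFFrom 0

wordsOver : ℕ → ℕ → List Word
wordsOver k zero    = [] ∷ []
wordsOver k (suc n) = concatMap (λ w → map (λ a → suc a ∷ w) (upTo k)) (wordsOver k n)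

-- R n : the RGFs of length n (every RGF of length n has letters ≤ n)
R : ℕ → List Word
R n = filter (λ w → T? (isRGF w)) (wordsOver n n)

rank : Word → ℕ → ℕ
rank w x = suc (length (filter (λ y → T? (y <ᵇ x)) (distinct w)))

standardize : Word → Word
standardize w = map (rank w) w

subwords : Word → List Word
subwords []       = [] ∷ []
subwords (x ∷ xs) = let s = subwords xs in map (x ∷_) s Data.List.++ s

contains : Word → Word → Bool
contains w v = any (λ u → standardize u == v) (subwords w)

avoids : Word → Word → Bool
avoids w v = not (contains w v)

Ravoid : ℕ → Word → Word → List Word
Ravoid n v₁ v₂ = filter (λ w → T? (avoids w v₁ ∧ avoids w v₂)) (R n)

-- lb statistic.  lbAux p w : p is the (reversed) prefix before w.

lbAt : Word → ℕ → ℕ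
lbAt p x = length (filter (λ y → T? (x <ᵇ y)) (distinct p))

lbAux : Word → Word → ℕ
lbAux p []       = 0
lbAux p (x ∷ xs) = lbAt p x + lbAux (x ∷ p) xs

lb : Word → ℕ
lb = lbAux []

-- Polynomials in q with ℕ coefficients, as coefficient functions
-- (coefficient of q^d).  Equality is pointwise (_≗_).

Poly : Set
Poly = ℕ → ℕ

one : Poly
one zero    = 1
one (suc _) = 0

_⊕_ : Poly → Poly → Poly
(p ⊕ r) d = p d + r d
infixl 6 _⊕_

_⊛_ : Poly → Poly → Poly
(p ⊛ r) d = sum (map (λ i → p i * r (d ∸ i)) (upTo (suc d)))
infixl 7 _⊛_

qpow·_ : ℕ → Poly → Poly
(qpow· k) p d = if k ≤ᵇ d then p (d ∸ k) else 0

Σ₁ : ℕ → (ℕ → Poly) → Poly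
Σ₁ zero    f = λ _ → 0
Σ₁ (suc m) f = Σ₁ m f ⊕ f (suc m)

LB : ℕ → Word → Word → Poly
LB n v₁ v₂ d = length (filter (λ w → lb w ℕ.≟ d) (Ravoid n v₁ v₂))

-- A word avoiding 111 and 1221 is read letter by letter in a state (m , e): m is its largest
-- letter and exactly the letters 1, …, e can no longer occur. The next letter is m + 1, or the
-- second copy of a letter a + 1 with e ≤ a < m, which adds m - a - 1 to lb and exhausts all
-- letters up to a + 1. So L n weighs the paths of length n on ℕ (counting the m - e open
-- letters) with up steps and jumps from j to any r < j of weight q^r, and these are Motzkin
-- paths: L = β₀ for the J-fractions β_c = 1 + q^c x β_c + q^c x² β_(c+1) β_c. Lifting paths
-- by one level gives L(qx) = α₁ for the variant α_c whose down steps carry an extra factor q,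
-- and comparing coefficients shows β₁ = 1 + q x α₁ + q x² α₁ β₁. Substituted into the equation
-- of β₀ this is L = 1 + x L + x² L + q x² L(qx) (L - 1), i.e. the recurrence.
module Submission where

open import Defs

open import Algebra using (CommutativeSemiring; IsCommutativeSemiring)
open import Data.Nat using (ℕ; zero; suc; _∸_; _≤_; z≤n; s≤s)
open import Data.Nat.Properties using (≤-refl; m≤n⇒m≤1+n)
open import Data.List using (_∷_; [])
open import Data.Product using (_×_; _,_)
open import Relation.Binary.PropositionalEquality using (_≗_)
open import Data.Empty using (⊥-elim)
import Algebra.Properties.CommutativeSemigroup as CommSemigroupProperties
import Relation.Binary.Reasoning.Setoid as SetoidReasoning

module BoolReflection where

  open import Data.Bool using (Bool; true; false; T; _∧_)
  open import Data.Bool.Properties using (T-≡)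
  open import Data.Nat using (_≡ᵇ_; _<ᵇ_)
  open import Data.Nat.Properties using (≡ᵇ⇒≡; ≡⇒≡ᵇ; <ᵇ⇒<; <-irrefl)
  open import Data.Product using (_×_; _,_)
  open import Data.Unit using (tt)
  open import Function.Bundles using (Equivalence)
  open import Relation.Nullary using (¬_)
  open import Relation.Binary.PropositionalEquality using (_≡_; refl)

  T⇒≡true : ∀ {b} → T b → b ≡ true
  T⇒≡true = Equivalence.to T-≡

  ≡true⇒T : ∀ {b} → b ≡ true → T b
  ≡true⇒T = Equivalence.from T-≡

  ¬T⇒≡false : ∀ {b} → ¬ T b → b ≡ false
  ¬T⇒≡false {true}  ¬t = ⊥-elim (¬t tt)
  ¬T⇒≡false {false} _  = refl

  ∧-true : ∀ a b → a ∧ b ≡ true → a ≡ true × b ≡ true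
  ∧-true true true _ = refl , refl

  ≡ᵇ-refl : ∀ a → (a ≡ᵇ a) ≡ true
  ≡ᵇ-refl a = T⇒≡true (≡⇒≡ᵇ a a refl)

  <ᵇ-irrefl : ∀ a → (a <ᵇ a) ≡ false
  <ᵇ-irrefl a = ¬T⇒≡false (λ t → <-irrefl refl (<ᵇ⇒< a a t))

  ≡ᵇ-true⇒≡ : ∀ a b → (a ≡ᵇ b) ≡ true → a ≡ b
  ≡ᵇ-true⇒≡ a b e = ≡ᵇ⇒≡ a b (≡true⇒T e)

open BoolReflection

module PowerSeries {c ℓ} (R : CommutativeSemiring c ℓ) where

  open CommutativeSemiring R hiding (isCommutativeSemiring)
  open CommSemigroupProperties +-commutativeSemigroup using (interchange)
  open SetoidReasoning setoid

  Series : Set c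
  Series = ℕ → Carrier

  infix 4 _≋_
  infixl 6 _⊞_
  infixl 7 _⊠_

  _≋_ : Series → Series → Set ℓ
  f ≋ g = ∀ n → f n ≈ g n

  _⊞_ : Series → Series → Series
  (f ⊞ g) n = f n + g n

  tail : Series → Series
  tail f n = f (suc n)

  _⊠_ : Series → Series → Series
  (f ⊠ g) zero    = f 0 * g 0
  (f ⊠ g) (suc n) = f 0 * g (suc n) + (tail f ⊠ g) n

  0ₛ : Series
  0ₛ _ = 0#

  1ₛ : Series
  1ₛ zero    = 1#
  1ₛ (suc _) = 0#

  scale : Carrier → Series → Series
  scale a f n = a * f n

  shift : Series → Series
  shift f zero    = 0#
  shift f (suc n) = f n

  ≋-refl : ∀ {f} → f ≋ f
  ≋-refl n = refl

  ≋-sym : ∀ {f g} → f ≋ g → g ≋ f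
  ≋-sym p n = sym (p n)

  ≋-trans : ∀ {f g h} → f ≋ g → g ≋ h → f ≋ h
  ≋-trans p q n = trans (p n) (q n)

  ⊞-cong : ∀ {f f′ g g′} → f ≋ f′ → g ≋ g′ → f ⊞ g ≋ f′ ⊞ g′
  ⊞-cong p q n = +-cong (p n) (q n)

  ⊠-cong : ∀ {f f′ g g′} → f ≋ f′ → g ≋ g′ → f ⊠ g ≋ f′ ⊠ g′
  ⊠-cong p q zero    = *-cong (p 0) (q 0)
  ⊠-cong p q (suc n) = +-cong (*-cong (p 0) (q (suc n))) (⊠-cong (λ k → p (suc k)) q n)

  ⊞-congˡ : ∀ f {g g′} → g ≋ g′ → f ⊞ g ≋ f ⊞ g′
  ⊞-congˡ f = ⊞-cong (≋-refl {f})

  ⊞-congʳ : ∀ {f f′} g → f ≋ f′ → f ⊞ g ≋ f′ ⊞ g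
  ⊞-congʳ g p = ⊞-cong p (≋-refl {g})

  ⊠-congˡ : ∀ f {g g′} → g ≋ g′ → f ⊠ g ≋ f ⊠ g′
  ⊠-congˡ f = ⊠-cong (≋-refl {f})

  ⊠-congʳ : ∀ {f f′} g → f ≋ f′ → f ⊠ g ≋ f′ ⊠ g
  ⊠-congʳ g p = ⊠-cong p (≋-refl {g})

  shift-cong : ∀ {f g} → f ≋ g → shift f ≋ shift g
  shift-cong p zero    = refl
  shift-cong p (suc n) = p n

  ⊠-zeroˡ : ∀ g → 0ₛ ⊠ g ≋ 0ₛ
  ⊠-zeroˡ g zero    = zeroˡ (g 0)
  ⊠-zeroˡ g (suc n) = trans (+-cong (zeroˡ (g (suc n))) (⊠-zeroˡ g n)) (+-identityʳ 0#)

  ⊠-zeroʳ : ∀ f → f ⊠ 0ₛ ≋ 0ₛ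
  ⊠-zeroʳ f zero    = zeroʳ (f 0)
  ⊠-zeroʳ f (suc n) = trans (+-cong (zeroʳ (f 0)) (⊠-zeroʳ (tail f) n)) (+-identityʳ 0#)

  ⊠-identityˡ : ∀ g → 1ₛ ⊠ g ≋ g
  ⊠-identityˡ g zero    = *-identityˡ (g 0)
  ⊠-identityˡ g (suc n) = trans (+-cong (*-identityˡ (g (suc n))) (⊠-zeroˡ g n)) (+-identityʳ _)

  ⊠-distribʳ : ∀ h f g → (f ⊞ g) ⊠ h ≋ f ⊠ h ⊞ g ⊠ h
  ⊠-distribʳ h f g zero    = distribʳ (h 0) (f 0) (g 0)
  ⊠-distribʳ h f g (suc n) = begin
    (f 0 + g 0) * h (suc n) + ((tail f ⊞ tail g) ⊠ h) n
      ≈⟨ +-cong (distribʳ (h (suc n)) (f 0) (g 0)) (⊠-distribʳ h (tail f) (tail g) n) ⟩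
    (f 0 * h (suc n) + g 0 * h (suc n)) + ((tail f ⊠ h) n + (tail g ⊠ h) n)
      ≈⟨ interchange _ _ _ _ ⟩
    (f 0 * h (suc n) + (tail f ⊠ h) n) + (g 0 * h (suc n) + (tail g ⊠ h) n) ∎

  ⊠-distribˡ : ∀ h f g → h ⊠ (f ⊞ g) ≋ h ⊠ f ⊞ h ⊠ g
  ⊠-distribˡ h f g zero    = distribˡ (h 0) (f 0) (g 0)
  ⊠-distribˡ h f g (suc n) = begin
    h 0 * (f (suc n) + g (suc n)) + (tail h ⊠ (f ⊞ g)) n
      ≈⟨ +-cong (distribˡ (h 0) (f (suc n)) (g (suc n))) (⊠-distribˡ (tail h) f g n) ⟩
    (h 0 * f (suc n) + h 0 * g (suc n)) + ((tail h ⊠ f) n + (tail h ⊠ g) n)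
      ≈⟨ interchange _ _ _ _ ⟩
    (h 0 * f (suc n) + (tail h ⊠ f) n) + (h 0 * g (suc n) + (tail h ⊠ g) n) ∎

  scale-⊠ : ∀ a f g → scale a f ⊠ g ≋ scale a (f ⊠ g)
  scale-⊠ a f g zero    = *-assoc a (f 0) (g 0)
  scale-⊠ a f g (suc n) = begin
    (a * f 0) * g (suc n) + (scale a (tail f) ⊠ g) n
      ≈⟨ +-cong (*-assoc a (f 0) (g (suc n))) (scale-⊠ a (tail f) g n) ⟩
    a * (f 0 * g (suc n)) + a * (tail f ⊠ g) n
      ≈⟨ sym (distribˡ a _ _) ⟩
    a * (f 0 * g (suc n) + (tail f ⊠ g) n) ∎

  ⊠-comm : ∀ f g → f ⊠ g ≋ g ⊠ f
  ⊠-comm f g zero = *-comm (f 0) (g 0)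
  ⊠-comm f g (suc zero) =
    trans (+-comm (f 0 * g 1) (f 1 * g 0)) (+-cong (*-comm (f 1) (g 0)) (*-comm (f 0) (g 1)))
  ⊠-comm f g (suc (suc n)) = begin
    f 0 * g (suc (suc n)) + (tail f ⊠ g) (suc n)
      ≈⟨ +-congˡ (⊠-comm (tail f) g (suc n)) ⟩
    f 0 * g (suc (suc n)) + (g 0 * f (suc (suc n)) + (tail g ⊠ tail f) n)
      ≈⟨ +-congˡ (+-congˡ (⊠-comm (tail g) (tail f) n)) ⟩
    f 0 * g (suc (suc n)) + (g 0 * f (suc (suc n)) + (tail f ⊠ tail g) n)
      ≈⟨ x∙yz≈y∙xz _ _ _ ⟩
    g 0 * f (suc (suc n)) + (f 0 * g (suc (suc n)) + (tail f ⊠ tail g) n)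
      ≈⟨ +-congˡ (sym (⊠-comm (tail g) f (suc n))) ⟩
    g 0 * f (suc (suc n)) + (tail g ⊠ f) (suc n) ∎
    where open CommSemigroupProperties +-commutativeSemigroup using (x∙yz≈y∙xz)

  ⊠-assoc : ∀ f g h → (f ⊠ g) ⊠ h ≋ f ⊠ (g ⊠ h)
  ⊠-assoc f g h zero    = *-assoc (f 0) (g 0) (h 0)
  ⊠-assoc f g h (suc n) = begin
    (f 0 * g 0) * h (suc n) + ((scale (f 0) (tail g) ⊞ (tail f ⊠ g)) ⊠ h) n
      ≈⟨ +-cong (*-assoc (f 0) (g 0) (h (suc n))) (⊠-distribʳ h (scale (f 0) (tail g)) (tail f ⊠ g) n) ⟩
    f 0 * (g 0 * h (suc n)) + ((scale (f 0) (tail g) ⊠ h) n + ((tail f ⊠ g) ⊠ h) n)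
      ≈⟨ +-congˡ (+-cong (scale-⊠ (f 0) (tail g) h n) (⊠-assoc (tail f) g h n)) ⟩
    f 0 * (g 0 * h (suc n)) + (f 0 * (tail g ⊠ h) n + (tail f ⊠ (g ⊠ h)) n)
      ≈⟨ sym (+-assoc _ _ _) ⟩
    (f 0 * (g 0 * h (suc n)) + f 0 * (tail g ⊠ h) n) + (tail f ⊠ (g ⊠ h)) n
      ≈⟨ +-congʳ (sym (distribˡ (f 0) _ _)) ⟩
    f 0 * (g 0 * h (suc n) + (tail g ⊠ h) n) + (tail f ⊠ (g ⊠ h)) n ∎

  shift-⊠ : ∀ f g → shift f ⊠ g ≋ shift (f ⊠ g)
  shift-⊠ f g zero    = zeroˡ (g 0)
  shift-⊠ f g (suc n) = trans (+-congʳ (zeroˡ _)) (+-identityˡ _)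

  ⊠-cong-upTo : ∀ f {g g′} n → (∀ k → k ≤ n → g k ≈ g′ k) → (f ⊠ g) n ≈ (f ⊠ g′) n
  ⊠-cong-upTo f zero    g≈g′ = *-congˡ (g≈g′ 0 z≤n)
  ⊠-cong-upTo f (suc n) g≈g′ =
    +-cong (*-congˡ (g≈g′ (suc n) ≤-refl)) (⊠-cong-upTo (tail f) n (λ k k≤n → g≈g′ k (m≤n⇒m≤1+n k≤n)))

  isCommutativeSemiring : IsCommutativeSemiring _≋_ _⊞_ _⊠_ 0ₛ 1ₛ
  isCommutativeSemiring = record
    { isSemiring = record
      { isSemiringWithoutAnnihilatingZero = record
        { +-isCommutativeMonoid = record
          { isMonoid = record
            { isSemigroup = record
              { isMagma = record
                { isEquivalence = record { refl = ≋-refl ; sym = ≋-sym ; trans = ≋-trans }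
                ; ∙-cong = ⊞-cong }
              ; assoc = λ f g h n → +-assoc (f n) (g n) (h n) }
            ; identity = (λ f n → +-identityˡ (f n)) , (λ f n → +-identityʳ (f n)) }
          ; comm = λ f g n → +-comm (f n) (g n) }
        ; *-cong = ⊠-cong
        ; *-assoc = ⊠-assoc
        ; *-identity = ⊠-identityˡ , (λ f → ≋-trans (⊠-comm f 1ₛ) (⊠-identityˡ f))
        ; distrib = ⊠-distribˡ , ⊠-distribʳ }
      ; zero = ⊠-zeroˡ , ⊠-zeroʳ }
    ; *-comm = ⊠-comm }

  commutativeSemiring : CommutativeSemiring c ℓ
  commutativeSemiring = record { isCommutativeSemiring = isCommutativeSemiring }


module QPolynomial where

  open import Data.Nat using (_+_; _*_; _∸_; _<_)
  open import Data.Nat.Properties using (+-*-commutativeSemiring; +-identityʳ; +-comm; +-assoc)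
  open import Data.List using (map)
  open import Data.List.Base using (upTo; applyUpTo)
  open import Data.List.Properties using (map-upTo)
  open import Data.Nat.ListAction using (sum)
  open import Relation.Binary.PropositionalEquality

  -- Poly is P.Series, with _⊕_ equal to P._⊞_ by definition.
  module P = PowerSeries +-*-commutativeSemiring
  open P public using () renaming (_⊠_ to _⊠ₚ_; 0ₛ to 0ₚ)

  one≗1ₚ : one ≗ P.1ₛ
  one≗1ₚ zero    = refl
  one≗1ₚ (suc d) = refl

  ⊛≗⊠ₚ : ∀ p r → p ⊛ r ≗ p ⊠ₚ r
  ⊛≗⊠ₚ p r d = trans (cong sum (map-upTo _ (suc d))) (go p d)
    where
    go : ∀ p d → sum (applyUpTo (λ i → p i * r (d ∸ i)) (suc d)) ≡ (p ⊠ₚ r) d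
    go p zero    = +-identityʳ _
    go p (suc d) = cong (p 0 * r (suc d) +_) (go (P.tail p) d)

  ⊛-cong : ∀ {p p′ r r′} → p ≗ p′ → r ≗ r′ → p ⊛ r ≗ p′ ⊛ r′
  ⊛-cong {p} {p′} {r} {r′} e f d =
    trans (⊛≗⊠ₚ p r d) (trans (P.⊠-cong e f d) (sym (⊛≗⊠ₚ p′ r′ d)))

  ⊕-cong : ∀ {p p′ r r′} → p ≗ p′ → r ≗ r′ → p ⊕ r ≗ p′ ⊕ r′
  ⊕-cong e f d = cong₂ _+_ (e d) (f d)

  qpow-suc : ∀ k p → (qpow· (suc k)) p ≗ P.shift ((qpow· k) p)
  qpow-suc k       p zero    = refl
  qpow-suc zero    p (suc d) = refl
  qpow-suc (suc k) p (suc d) = refl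

  qpow-cong : ∀ k {p r} → p ≗ r → (qpow· k) p ≗ (qpow· k) r
  qpow-cong zero    e d = e d
  qpow-cong (suc k) {p} {r} e d =
    trans (qpow-suc k p d) (trans (P.shift-cong (qpow-cong k e) d) (sym (qpow-suc k r d)))

  qpow-exp : ∀ {a b} p → a ≡ b → (qpow· a) p ≗ (qpow· b) p
  qpow-exp p refl d = refl

  qpow-+ : ∀ a b p → (qpow· a) ((qpow· b) p) ≗ (qpow· (a + b)) p
  qpow-+ zero    b p d = refl
  qpow-+ (suc a) b p d =
    trans (qpow-suc a ((qpow· b) p) d) (trans (P.shift-cong (qpow-+ a b p) d) (sym (qpow-suc (a + b) p d)))

  qpow-qpow-exp : ∀ a b a′ b′ p → a + b ≡ a′ + b′ → (qpow· a) ((qpow· b) p) ≗ (qpow· a′) ((qpow· b′) p)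
  qpow-qpow-exp a b a′ b′ p eq d =
    trans (qpow-+ a b p d) (trans (qpow-exp p eq d) (sym (qpow-+ a′ b′ p d)))

  qpow-⊕ : ∀ k p r → (qpow· k) (p ⊕ r) ≗ (qpow· k) p ⊕ (qpow· k) r
  qpow-⊕ zero    p r d       = refl
  qpow-⊕ (suc k) p r zero    = refl
  qpow-⊕ (suc k) p r (suc d) = trans (qpow-suc k (p ⊕ r) (suc d)) (trans (qpow-⊕ k p r d)
    (sym (cong₂ _+_ (qpow-suc k p (suc d)) (qpow-suc k r (suc d)))))

  qpow-0ₚ : ∀ k → (qpow· k) 0ₚ ≗ 0ₚ
  qpow-0ₚ zero    d       = refl
  qpow-0ₚ (suc k) zero    = refl
  qpow-0ₚ (suc k) (suc d) = trans (qpow-suc k 0ₚ (suc d)) (qpow-0ₚ k d)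

  qpow-⊠ₚ : ∀ k p r → (qpow· k) (p ⊠ₚ r) ≗ (qpow· k) p ⊠ₚ r
  qpow-⊠ₚ zero    p r d = refl
  qpow-⊠ₚ (suc k) p r d = trans (qpow-suc k (p ⊠ₚ r) d) (trans (P.shift-cong (qpow-⊠ₚ k p r) d)
    (trans (sym (P.shift-⊠ ((qpow· k) p) r d)) (P.⊠-cong (λ e → sym (qpow-suc k p e)) (λ _ → refl) d)))

  monomial : ℕ → Poly
  monomial k = (qpow· k) one

  qpow≗monomial⊠ₚ : ∀ k p → (qpow· k) p ≗ monomial k ⊠ₚ p
  qpow≗monomial⊠ₚ k p d = trans (qpow-cong k (λ e → sym (P.⊠-identityˡ p e)) d)
    (trans (qpow-⊠ₚ k P.1ₛ p d) (P.⊠-cong (qpow-cong k (λ e → sym (one≗1ₚ e))) (λ _ → refl) d))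


  Σ₁-cong : ∀ n {F G : ℕ → Poly} → (∀ k → F k ≗ G k) → Σ₁ n F ≗ Σ₁ n G
  Σ₁-cong zero    e d = refl
  Σ₁-cong (suc n) e d = cong₂ _+_ (Σ₁-cong n e d) (e (suc n) d)

  Σ₁-cong-< : ∀ n {F G} → (∀ j → j < n → F (suc j) ≗ G (suc j)) → Σ₁ n F ≗ Σ₁ n G
  Σ₁-cong-< zero    e d = refl
  Σ₁-cong-< (suc n) e d = cong₂ _+_ (Σ₁-cong-< n (λ j j<n → e j (m≤n⇒m≤1+n j<n)) d) (e n ≤-refl d)

  Σ₁-suc-front : ∀ n F → Σ₁ (suc n) F ≗ F 1 ⊕ Σ₁ n (λ k → F (suc k))
  Σ₁-suc-front zero    F d = sym (+-identityʳ (F 1 d))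
  Σ₁-suc-front (suc n) F d = trans (cong (_+ F (suc (suc n)) d) (Σ₁-suc-front n F d)) (+-assoc (F 1 d) _ _)

  qpow-Σ₁ : ∀ k n F → (qpow· k) (Σ₁ n F) ≗ Σ₁ n (λ j → (qpow· k) (F j))
  qpow-Σ₁ k zero    F d = qpow-0ₚ k d
  qpow-Σ₁ k (suc n) F d =
    trans (qpow-⊕ k (Σ₁ n F) (F (suc n)) d) (cong (_+ (qpow· k) (F (suc n)) d) (qpow-Σ₁ k n F d))

  Σ< : ℕ → (ℕ → Poly) → Poly
  Σ< zero    f = 0ₚ
  Σ< (suc k) f = f 0 ⊕ Σ< k (λ a → f (suc a))

  Σ<-cong-< : ∀ k {f g} → (∀ a → a < k → f a ≗ g a) → Σ< k f ≗ Σ< k g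
  Σ<-cong-< zero    e d = refl
  Σ<-cong-< (suc k) e d = cong₂ _+_ (e 0 (s≤s z≤n) d) (Σ<-cong-< k (λ a a<k → e (suc a) (s≤s a<k)) d)

  Σ<-cong : ∀ k {f g} → (∀ a → f a ≗ g a) → Σ< k f ≗ Σ< k g
  Σ<-cong k e = Σ<-cong-< k (λ a _ → e a)

  Σ<-zero : ∀ k f → (∀ a → a < k → f a ≗ 0ₚ) → Σ< k f ≗ 0ₚ
  Σ<-zero zero    f z d = refl
  Σ<-zero (suc k) f z d =
    cong₂ _+_ (z 0 (s≤s z≤n) d) (Σ<-zero k (λ a → f (suc a)) (λ a a<k → z (suc a) (s≤s a<k)) d)

  Σ<-suc : ∀ k f → Σ< (suc k) f ≗ Σ< k f ⊕ f k
  Σ<-suc zero    f d = +-comm (f 0 d) 0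
  Σ<-suc (suc k) f d = trans (cong (f 0 d +_) (Σ<-suc k (λ a → f (suc a)) d)) (sym (+-assoc (f 0 d) _ _))

  Σ<-+ : ∀ a b f → Σ< (a + b) f ≗ Σ< a f ⊕ Σ< b (λ i → f (a + i))
  Σ<-+ zero    b f d = refl
  Σ<-+ (suc a) b f d = trans (cong (f 0 d +_) (Σ<-+ a b (λ i → f (suc i)) d)) (sym (+-assoc (f 0 d) _ _))

  Σ<-truncate : ∀ t k f → t ≤ k → (∀ a → t ≤ a → f a ≗ 0ₚ) → Σ< k f ≗ Σ< t f
  Σ<-truncate zero    k       f _         z = Σ<-zero k f (λ a _ → z a z≤n)
  Σ<-truncate (suc t) (suc k) f (s≤s t≤k) z d =
    cong (f 0 d +_) (Σ<-truncate t k (λ a → f (suc a)) t≤k (λ a t≤a → z (suc a) (s≤s t≤a)) d)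

  Σ<-reverse : ∀ k f → Σ< k (λ i → f (k ∸ suc i)) ≗ Σ< k f
  Σ<-reverse zero    f d = refl
  Σ<-reverse (suc k) f d =
    trans (cong (f k d +_) (Σ<-reverse k f d)) (trans (+-comm (f k d) _) (sym (Σ<-suc k f d)))

  qpow-Σ< : ∀ q k f → (qpow· q) (Σ< k f) ≗ Σ< k (λ a → (qpow· q) (f a))
  qpow-Σ< q zero    f d = qpow-0ₚ q d
  qpow-Σ< q (suc k) f d = trans (qpow-⊕ q (f 0) (Σ< k (λ a → f (suc a))) d)
                                (cong ((qpow· q) (f 0) d +_) (qpow-Σ< q k (λ a → f (suc a)) d))

  sum-upTo≡Σ< : ∀ k f d → sum (map (λ a → f a d) (upTo k)) ≡ Σ< k f d
  sum-upTo≡Σ< k f d = trans (cong sum (map-upTo (λ a → f a d) k)) (go k f)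
    where
    go : ∀ k f → sum (applyUpTo (λ a → f a d) k) ≡ Σ< k f d
    go zero    f = refl
    go (suc k) f = cong (f 0 d +_) (go k (λ a → f (suc a)))

module MotzkinPaths where

  open QPolynomial
  open import Data.Nat using (_+_; _<_)
  open import Data.Nat.Properties
    using (+-suc; +-identityʳ; +-comm; +-cancelʳ-≡; ≤-pred; ≤-<-trans; m≤n⇒m<n∨m≡n)
  open import Data.Sum using (inj₁; inj₂)
  open import Relation.Binary.PropositionalEquality
  open import Data.Nat.Solver using (module +-*-Solver)
  open +-*-Solver using (solve; _:=_; _:+_; con)
  open import Algebra using (CommutativeSemiring)
  import Relation.Binary.Reasoning.Setoid as SetoidReasoning

  -- power series in x whose coefficients are polynomials in q
  module S = PowerSeries P.commutativeSemiring
  open S public using (Series; _≋_; _⊞_; _⊠_; tail; shift; 1ₛ; 0ₛ)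

  -- motzkin c t n h is the weight of the Motzkin paths of length n from height h to height 0,
  -- where a level step at height h weighs q^(h+c), a down step from height g+1 weighs q^(g+c+t)
  -- and an up step weighs 1.
  mutual
    motzkin : ℕ → ℕ → ℕ → ℕ → Poly
    motzkin c t zero    zero    = one
    motzkin c t zero    (suc h) = 0ₚ
    motzkin c t (suc n) h       =
      (qpow· (h + c)) (motzkin c t n h) ⊕ motzkin c t n (suc h) ⊕ descent c t n h

    descent : ℕ → ℕ → ℕ → ℕ → Poly
    descent c t n zero    = 0ₚ
    descent c t n (suc g) = (qpow· (g + c + t)) (motzkin c t n g)

  motzkinₛ : ℕ → ℕ → ℕ → Series
  motzkinₛ c t h n = motzkin c t n h

  descentₛ : ℕ → ℕ → ℕ → Series
  descentₛ c t h n = descent c t n h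

  qpowₛ : ℕ → Series → Series
  qpowₛ k f n = (qpow· k) (f n)

  qpowₛ-⊠ : ∀ k f g → qpowₛ k f ⊠ g ≋ qpowₛ k (f ⊠ g)
  qpowₛ-⊠ k f g n d = begin
    (qpowₛ k f ⊠ g) n d       ≡⟨ S.⊠-cong (λ m → qpow≗monomial⊠ₚ k (f m)) S.≋-refl n d ⟩
    (S.scale (monomial k) f ⊠ g) n d ≡⟨ S.scale-⊠ (monomial k) f g n d ⟩
    (monomial k ⊠ₚ (f ⊠ g) n) d ≡⟨ sym (qpow≗monomial⊠ₚ k ((f ⊠ g) n) d) ⟩
    qpowₛ k (f ⊠ g) n d ∎
    where open ≡-Reasoning

  tail-motzkinₛ-⊠ : ∀ c t h g n → (tail (motzkinₛ c t h) ⊠ g) n ≗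
    (qpow· (h + c)) ((motzkinₛ c t h ⊠ g) n) ⊕ (motzkinₛ c t (suc h) ⊠ g) n ⊕ (descentₛ c t h ⊠ g) n
  tail-motzkinₛ-⊠ c t h g n d = begin
    (tail M ⊠ g) n d
      ≡⟨ S.⊠-distribʳ g (qpowₛ (h + c) M ⊞ M′) D n d ⟩
    ((qpowₛ (h + c) M ⊞ M′) ⊠ g) n d + (D ⊠ g) n d
      ≡⟨ cong (_+ (D ⊠ g) n d) (S.⊠-distribʳ g (qpowₛ (h + c) M) M′ n d) ⟩
    (qpowₛ (h + c) M ⊠ g) n d + (M′ ⊠ g) n d + (D ⊠ g) n d
      ≡⟨ cong (λ z → z + (M′ ⊠ g) n d + (D ⊠ g) n d) (qpowₛ-⊠ (h + c) M g n d) ⟩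
    (qpow· (h + c)) ((M ⊠ g) n) d + (M′ ⊠ g) n d + (D ⊠ g) n d ∎
    where
    open ≡-Reasoning
    M M′ D : Series
    M  = motzkinₛ c t h
    M′ = motzkinₛ c t (suc h)
    D  = descentₛ c t h

  one-⊠ₚ : ∀ p → one ⊠ₚ p ≗ p
  one-⊠ₚ p d = trans (P.⊠-cong one≗1ₚ (λ _ → refl) d) (P.⊠-identityˡ p d)

  -- A path from height h+1 first reaches height 0 by a down step of weight q^(c+t);
  -- before that it is a path from h to 0 lifted by one level, which adds 1 to c.
  motzkin-firstPassage : ∀ c t h n →
    motzkin c t (suc n) (suc h) ≗ (qpow· (c + t)) ((motzkinₛ (suc c) t h ⊠ motzkinₛ c t 0) n)
  motzkin-firstPassage c t zero zero d =
    cong₂ _+_ (cong (_+ 0) (qpow-0ₚ (suc c) d)) (sym (qpow-cong (c + t) (one-⊠ₚ one) d))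
  motzkin-firstPassage c t (suc h) zero d =
    trans (cong₂ _+_ (cong (_+ 0) (qpow-0ₚ (suc (suc h) + c) d)) (qpow-0ₚ (suc h + c + t) d))
          (sym (trans (qpow-cong (c + t) (P.⊠-zeroˡ one) d) (qpow-0ₚ (c + t) d)))
  motzkin-firstPassage c t h (suc n) d = begin
    (qpow· (suc h + c)) (motzkin c t (suc n) (suc h)) d + motzkin c t (suc n) (suc (suc h)) d
      + descent c t (suc n) (suc h) d
      ≡⟨ cong₂ _+_ (cong₂ _+_ (qpow-cong (suc h + c) (motzkin-firstPassage c t h n) d)
                              (motzkin-firstPassage c t (suc h) n d))
                   (descent-firstPassage h d) ⟩
    (qpow· (suc h + c)) (lift (Y h)) d + lift (Y (suc h)) d + (lift (I h) d + lift (D h) d)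
      ≡⟨ cong (λ z → z + lift (Y (suc h)) d + (lift (I h) d + lift (D h) d))
              (qpow-qpow-exp (suc h + c) (c + t) (c + t) (h + suc c) (Y h) exponents d) ⟩
    lift (Yₕ′) d + lift (Y (suc h)) d + (lift (I h) d + lift (D h) d)
      ≡⟨ solve 4 (λ a b i e → a :+ b :+ (i :+ e) := i :+ (a :+ b :+ e)) refl
               (lift Yₕ′ d) (lift (Y (suc h)) d) (lift (I h) d) (lift (D h) d) ⟩
    lift (I h) d + (lift Yₕ′ d + lift (Y (suc h)) d + lift (D h) d)
      ≡⟨ cong (lift (I h) d +_) (sym (trans (qpow-⊕ (c + t) (Yₕ′ ⊕ Y (suc h)) (D h) d)
                                             (cong (_+ lift (D h) d) (qpow-⊕ (c + t) Yₕ′ (Y (suc h)) d)))) ⟩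
    lift (I h) d + lift (Yₕ′ ⊕ Y (suc h) ⊕ D h) d
      ≡⟨ cong (lift (I h) d +_) (sym (qpow-cong (c + t) (tail-motzkinₛ-⊠ (suc c) t h B n) d)) ⟩
    lift (I h) d + lift ((tail (motzkinₛ (suc c) t h) ⊠ B) n) d
      ≡⟨ sym (qpow-⊕ (c + t) (I h) ((tail (motzkinₛ (suc c) t h) ⊠ B) n) d) ⟩
    lift ((motzkinₛ (suc c) t h ⊠ B) (suc n)) d ∎
    where
    open ≡-Reasoning
    lift : Poly → Poly
    lift = qpow· (c + t)
    B : Series
    B = motzkinₛ c t 0
    Y : ℕ → Poly
    Y h = (motzkinₛ (suc c) t h ⊠ B) n
    Yₕ′ : Poly
    Yₕ′ = (qpow· (h + suc c)) (Y h)
    I : ℕ → Poly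
    I h = motzkin (suc c) t 0 h ⊠ₚ B (suc n)
    D : ℕ → Poly
    D h = (descentₛ (suc c) t h ⊠ B) n
    exponents : suc h + c + (c + t) ≡ c + t + (h + suc c)
    exponents = trans (+-comm (suc h + c) (c + t)) (cong (c + t +_) (sym (+-suc h c)))
    descent-firstPassage : ∀ h → descent c t (suc n) (suc h) ≗ lift (I h) ⊕ lift (D h)
    descent-firstPassage zero e =
      sym (trans (cong₂ _+_ (qpow-cong (c + t) (one-⊠ₚ (B (suc n))) e)
                            (trans (qpow-cong (c + t) (S.⊠-zeroˡ B n) e) (qpow-0ₚ (c + t) e)))
                 (+-identityʳ _))
    descent-firstPassage (suc g) e = begin
      (qpow· (suc g + c + t)) (motzkin c t (suc n) (suc g)) e
        ≡⟨ qpow-cong (suc g + c + t) (motzkin-firstPassage c t g n) e ⟩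
      (qpow· (suc g + c + t)) (lift (Y g)) e
        ≡⟨ qpow-qpow-exp (suc g + c + t) (c + t) (c + t) (suc g + c + t) (Y g)
                         (+-comm (suc g + c + t) (c + t)) e ⟩
      lift ((qpow· (suc g + c + t)) (Y g)) e
        ≡⟨ qpow-cong (c + t) (λ e′ → trans (qpow-exp (Y g) (cong (_+ t) (sym (+-suc g c))) e′)
                                           (sym (qpowₛ-⊠ (g + suc c + t) (motzkinₛ (suc c) t g) B n e′))) e ⟩
      lift (D (suc g)) e
        ≡⟨ sym (cong (_+ lift (D (suc g)) e)
                     (trans (qpow-cong (c + t) (P.⊠-zeroˡ (B (suc n))) e) (qpow-0ₚ (c + t) e))) ⟩
      lift (I (suc g)) e + lift (D (suc g)) e ∎

  const : Poly → Series
  const p zero    = p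
  const p (suc _) = 0ₚ

  Q : ℕ → Series
  Q k = const (monomial k)

  X : Series
  X = shift 1ₛ

  const-⊠ : ∀ p f n → (const p ⊠ f) n ≗ p ⊠ₚ f n
  const-⊠ p f zero    d = refl
  const-⊠ p f (suc n) d = trans (cong ((p ⊠ₚ f (suc n)) d +_) (S.⊠-zeroˡ f n d)) (+-identityʳ _)

  Q-⊠ : ∀ k f → Q k ⊠ f ≋ qpowₛ k f
  Q-⊠ k f n d = trans (const-⊠ (monomial k) f n d) (sym (qpow≗monomial⊠ₚ k (f n) d))

  Q-+ : ∀ a b → Q (a + b) ≋ Q a ⊠ Q b
  Q-+ a b zero    d = trans (sym (qpow-+ a b one d)) (qpow≗monomial⊠ₚ a (monomial b) d)
  Q-+ a b (suc n) d =
    sym (trans (cong (_+ (0ₛ ⊠ Q b) n d) (P.⊠-zeroʳ (monomial a) d)) (S.⊠-zeroˡ (Q b) n d))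

  X-⊠ : ∀ f → X ⊠ f ≋ shift f
  X-⊠ f = S.≋-trans (S.shift-⊠ 1ₛ f) (S.shift-cong (S.⊠-identityˡ f))

  import Algebra.Solver.Ring.NaturalCoefficients.Default as SemiringSolver
  module Solver = SemiringSolver S.commutativeSemiring
  open Solver public using ()
    renaming (solve to solveₛ; _:+_ to _+ₑ_; _:*_ to _*ₑ_; _:=_ to _=ₑ_; con to conₑ)

  motzkinₛ-unfold : ∀ c t → motzkinₛ c t 0 ≋
    1ₛ ⊞ shift (qpowₛ c (motzkinₛ c t 0) ⊞ shift (qpowₛ (c + t) (motzkinₛ (suc c) t 0 ⊠ motzkinₛ c t 0)))
  motzkinₛ-unfold c t zero          d = trans (one≗1ₚ d) (sym (+-identityʳ _))
  motzkinₛ-unfold c t (suc zero)    d = +-identityʳ _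
  motzkinₛ-unfold c t (suc (suc m)) d =
    trans (+-identityʳ _) (cong ((qpow· c) (motzkin c t (suc m) 0) d +_) (motzkin-firstPassage c t 0 m d))

  motzkinₛ-jfraction : ∀ c t → motzkinₛ c t 0 ≋
    1ₛ ⊞ Q c ⊠ X ⊠ motzkinₛ c t 0 ⊞ Q (c + t) ⊠ X ⊠ X ⊠ motzkinₛ (suc c) t 0 ⊠ motzkinₛ c t 0
  motzkinₛ-jfraction c t = S.≋-trans (motzkinₛ-unfold c t) (S.≋-trans (S.⊞-cong S.≋-refl
    (S.≋-trans (S.shift-cong (S.⊞-cong (S.≋-sym (Q-⊠ c (motzkinₛ c t 0)))
      (S.≋-trans (S.shift-cong (S.≋-sym (Q-⊠ (c + t) _))) (S.≋-sym (X-⊠ _)))))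
      (S.≋-sym (X-⊠ _))))
    (solveₛ 5 (λ x a b f g → conₑ 1 +ₑ x *ₑ (a *ₑ f +ₑ x *ₑ (b *ₑ (g *ₑ f)))
                            =ₑ conₑ 1 +ₑ a *ₑ x *ₑ f +ₑ b *ₑ x *ₑ x *ₑ g *ₑ f)
      S.≋-refl X (Q c) (Q (c + t)) (motzkinₛ c t 0) (motzkinₛ (suc c) t 0)))

  β α ρ : ℕ → Series
  β c = motzkinₛ c 0 0
  α c = motzkinₛ c 1 0
  ρ c = 1ₛ ⊞ Q c ⊠ X ⊠ α c ⊞ Q c ⊠ X ⊠ X ⊠ α c ⊠ β c

  β-jfraction : ∀ c → β c ≋ 1ₛ ⊞ Q c ⊠ X ⊠ β c ⊞ Q c ⊠ X ⊠ X ⊠ β (suc c) ⊠ β c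
  β-jfraction c = subst (λ k → β c ≋ 1ₛ ⊞ Q c ⊠ X ⊠ β c ⊞ Q k ⊠ X ⊠ X ⊠ β (suc c) ⊠ β c)
                        (+-identityʳ c) (motzkinₛ-jfraction c 0)

  α-jfraction : ∀ c → α c ≋ 1ₛ ⊞ Q c ⊠ X ⊠ α c ⊞ Q 1 ⊠ Q c ⊠ X ⊠ X ⊠ α (suc c) ⊠ α c
  α-jfraction c = S.≋-trans (motzkinₛ-jfraction c 1)
    (S.⊞-congˡ (1ₛ ⊞ Q c ⊠ X ⊠ α c) (S.⊠-congʳ (α c) (S.⊠-congʳ (α (suc c)) (S.⊠-congʳ X (S.⊠-congʳ X
      (subst (λ k → Q k ≋ Q 1 ⊠ Q c) (+-comm 1 c) (Q-+ 1 c)))))))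

  βStep correction : ℕ → Series → Series
  βStep c f = 1ₛ ⊞ Q c ⊠ X ⊠ β c ⊞ Q c ⊠ X ⊠ X ⊠ f ⊠ β c
  correction c f = Q c ⊠ X ⊠ f ⊞ Q 1 ⊠ Q c ⊠ X ⊠ X ⊠ α (suc c) ⊠ f

  ρ-suc : ∀ c → ρ (suc c) ≋
    1ₛ ⊞ Q 1 ⊠ Q c ⊠ X ⊠ α (suc c) ⊞ Q 1 ⊠ Q c ⊠ X ⊠ X ⊠ α (suc c) ⊠ β (suc c)
  ρ-suc c = S.⊞-cong (S.⊞-congˡ 1ₛ (S.⊠-congʳ (α (suc c)) (S.⊠-congʳ X (Q-+ 1 c))))
                     (S.⊠-congʳ (β (suc c)) (S.⊠-congʳ (α (suc c)) (S.⊠-congʳ X (S.⊠-congʳ X (Q-+ 1 c)))))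

  ⊞-cancelʳ : ∀ {f g k} → f ⊞ k ≋ g ⊞ k → f ≋ g
  ⊞-cancelʳ {f} {g} {k} e n d = +-cancelʳ-≡ (k n d) (f n d) (g n d) (e n d)

  -- The two sides differ by a combination of the J-fraction equations of β c and α c,
  -- which is added to both sides as the term K below and then cancelled.
  βStep-ρ : ∀ c → βStep c (ρ (suc c)) ⊞ correction c (ρ c) ≋ ρ c ⊞ correction c (β c)
  βStep-ρ c = ⊞-cancelʳ (begin
    βStep c (ρ (suc c)) ⊞ correction c (ρ c) ⊞ K (β c) (α c)
      ≈⟨ S.⊞-congʳ (K (β c) (α c)) (S.⊞-congʳ (correction c (ρ c))
           (S.⊞-congˡ (1ₛ ⊞ Q c ⊠ X ⊠ β c) (S.⊠-congʳ (β c) (S.⊠-congˡ (Q c ⊠ X ⊠ X) (ρ-suc c))))) ⟩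
    βStep c ρ′ ⊞ correction c (ρ c) ⊞ K (β c) (α c)
      ≈⟨ identity X (Q c) (Q 1) (α c) (β c) (α (suc c)) (β (suc c)) ⟩
    ρ c ⊞ correction c (β c) ⊞ K βRhs αRhs
      ≈⟨ S.⊞-congˡ (ρ c ⊞ correction c (β c)) (S.⊞-cong
           (S.⊠-congˡ (Q 1 ⊠ Q c ⊠ X ⊠ X ⊠ α (suc c)) (S.≋-sym (β-jfraction c)))
           (S.⊠-congˡ (Q c ⊠ X ⊠ (1ₛ ⊞ X ⊠ β c)) (S.≋-sym (α-jfraction c)))) ⟩
    ρ c ⊞ correction c (β c) ⊞ K (β c) (α c) ∎)
    where
    open SetoidReasoning (CommutativeSemiring.setoid S.commutativeSemiring)
    K : Series → Series → Series
    K u v = Q 1 ⊠ Q c ⊠ X ⊠ X ⊠ α (suc c) ⊠ u ⊞ Q c ⊠ X ⊠ (1ₛ ⊞ X ⊠ β c) ⊠ v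
    ρ′ βRhs αRhs : Series
    ρ′ = 1ₛ ⊞ Q 1 ⊠ Q c ⊠ X ⊠ α (suc c) ⊞ Q 1 ⊠ Q c ⊠ X ⊠ X ⊠ α (suc c) ⊠ β (suc c)
    βRhs = 1ₛ ⊞ Q c ⊠ X ⊠ β c ⊞ Q c ⊠ X ⊠ X ⊠ β (suc c) ⊠ β c
    αRhs = 1ₛ ⊞ Q c ⊠ X ⊠ α c ⊞ Q 1 ⊠ Q c ⊠ X ⊠ X ⊠ α (suc c) ⊠ α c
    identity = solveₛ 7 (λ x a q al be al1 be1 →
      let R  = conₑ 1 +ₑ a *ₑ x *ₑ al +ₑ a *ₑ x *ₑ x *ₑ al *ₑ be
          R1 = conₑ 1 +ₑ q *ₑ a *ₑ x *ₑ al1 +ₑ q *ₑ a *ₑ x *ₑ x *ₑ al1 *ₑ be1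
          Tₑ = λ f → a *ₑ x *ₑ f +ₑ q *ₑ a *ₑ x *ₑ x *ₑ al1 *ₑ f
          Kₑ = λ u v → q *ₑ a *ₑ x *ₑ x *ₑ al1 *ₑ u +ₑ a *ₑ x *ₑ (conₑ 1 +ₑ x *ₑ be) *ₑ v
      in (conₑ 1 +ₑ a *ₑ x *ₑ be +ₑ a *ₑ x *ₑ x *ₑ R1 *ₑ be) +ₑ Tₑ R +ₑ Kₑ be al
         =ₑ R +ₑ Tₑ be +ₑ Kₑ (conₑ 1 +ₑ a *ₑ x *ₑ be +ₑ a *ₑ x *ₑ x *ₑ be1 *ₑ be)
                             (conₑ 1 +ₑ a *ₑ x *ₑ al +ₑ q *ₑ a *ₑ x *ₑ x *ₑ al1 *ₑ al))
      S.≋-refl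

  infix 4 _≈[<_]_
  _≈[<_]_ : Series → ℕ → Series → Set
  f ≈[< m ] g = ∀ k → k < m → f k ≗ g k

  ≋⇒≈[<] : ∀ {f g m} → f ≋ g → f ≈[< m ] g
  ≋⇒≈[<] e k _ = e k

  ≈[<]-trans : ∀ {f g h m} → f ≈[< m ] g → g ≈[< m ] h → f ≈[< m ] h
  ≈[<]-trans e₁ e₂ k k<m d = trans (e₁ k k<m d) (e₂ k k<m d)

  ≈[<]-weaken : ∀ {f g m} → f ≈[< suc m ] g → f ≈[< m ] g
  ≈[<]-weaken e k k<m = e k (m≤n⇒m≤1+n k<m)

  ≈[<]-extend : ∀ {f g m} → f ≈[< m ] g → f m ≗ g m → f ≈[< suc m ] g
  ≈[<]-extend e top k k<1+m with m≤n⇒m<n∨m≡n (≤-pred k<1+m)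
  ... | inj₁ k<m = e k k<m
  ... | inj₂ refl = top

  ≈[<]-⊞ : ∀ {f f′ g g′ m} → f ≈[< m ] f′ → g ≈[< m ] g′ → f ⊞ g ≈[< m ] f′ ⊞ g′
  ≈[<]-⊞ e₁ e₂ k k<m d = cong₂ _+_ (e₁ k k<m d) (e₂ k k<m d)

  ≈[<]-⊠ˡ : ∀ h {g g′ m} → g ≈[< m ] g′ → h ⊠ g ≈[< m ] h ⊠ g′
  ≈[<]-⊠ˡ h e k k<m = S.⊠-cong-upTo h k (λ j j≤k → e j (≤-<-trans j≤k k<m))

  X-⊠-≈[<] : ∀ {f g m} → f ≈[< m ] g → X ⊠ f ≈[< suc m ] X ⊠ g
  X-⊠-≈[<] {f} {g} e zero    _         d = trans (X-⊠ f 0 d) (sym (X-⊠ g 0 d))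
  X-⊠-≈[<] {f} {g} e (suc k) (s≤s k<m) d = trans (X-⊠ f (suc k) d) (trans (e k k<m d) (sym (X-⊠ g (suc k) d)))

  correction-≈[<] : ∀ c {f g m} → f ≈[< m ] g → correction c f ≈[< suc m ] correction c g
  correction-≈[<] c {f} {g} e =
    ≈[<]-trans (≋⇒≈[<] (factor f)) (≈[<]-trans (X-⊠-≈[<] (≈[<]-⊞ (≈[<]-⊠ˡ (Q c) e) (≈[<]-⊠ˡ A e)))
                                              (≋⇒≈[<] (S.≋-sym (factor g))))
    where
    A : Series
    A = Q 1 ⊠ Q c ⊠ X ⊠ α (suc c)
    factor : ∀ f → correction c f ≋ X ⊠ (Q c ⊠ f ⊞ A ⊠ f)
    factor f = solveₛ 5 (λ x a q al1 f → a *ₑ x *ₑ f +ₑ q *ₑ a *ₑ x *ₑ x *ₑ al1 *ₑ f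
                                      =ₑ x *ₑ (a *ₑ f +ₑ q *ₑ a *ₑ x *ₑ al1 *ₑ f))
                         S.≋-refl X (Q c) (Q 1) (α (suc c)) f

  βStep-≈[<] : ∀ c {f g m} → f ≈[< m ] g → βStep c f ≈[< suc m ] βStep c g
  βStep-≈[<] c {f} {g} e = ≈[<]-weaken (≈[<]-trans (≋⇒≈[<] (factor f))
    (≈[<]-trans (≈[<]-⊞ (≋⇒≈[<] S.≋-refl)
                        (X-⊠-≈[<] (X-⊠-≈[<] (≈[<]-⊠ˡ (Q c) (≈[<]-⊠ˡ (β c) e)))))
                (≋⇒≈[<] (S.≋-sym (factor g)))))
    where
    factor : ∀ f → βStep c f ≋ (1ₛ ⊞ Q c ⊠ X ⊠ β c) ⊞ X ⊠ (X ⊠ (Q c ⊠ (β c ⊠ f)))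
    factor f = solveₛ 4 (λ x a be f → conₑ 1 +ₑ a *ₑ x *ₑ be +ₑ a *ₑ x *ₑ x *ₑ f *ₑ be
                                   =ₑ conₑ 1 +ₑ a *ₑ x *ₑ be +ₑ x *ₑ (x *ₑ (a *ₑ (be *ₑ f))))
                         S.≋-refl X (Q c) (β c) f

  -- By βStep-ρ, ρ satisfies the J-fraction equation of β up to the term correction, whose m-th
  -- coefficient only involves lower coefficients; so induction on m, for all c at once.
  β≈[<]ρ : ∀ m c → β c ≈[< m ] ρ c
  β≈[<]ρ zero    c k ()
  β≈[<]ρ (suc m) c = ≈[<]-extend IH top
    where
    IH = β≈[<]ρ m c
    top : β c m ≗ ρ c m
    top d = +-cancelʳ-≡ (correction c (ρ c) m d) (β c m d) (ρ c m d) (begin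
      β c m d + correction c (ρ c) m d
        ≡⟨ cong (_+ correction c (ρ c) m d)
                (trans (β-jfraction c m d) (βStep-≈[<] c (β≈[<]ρ m (suc c)) m ≤-refl d)) ⟩
      βStep c (ρ (suc c)) m d + correction c (ρ c) m d
        ≡⟨ βStep-ρ c m d ⟩
      ρ c m d + correction c (β c) m d
        ≡⟨ cong (ρ c m d +_) (correction-≈[<] c IH m ≤-refl d) ⟩
      ρ c m d + correction c (ρ c) m d ∎)
      where open ≡-Reasoning

  β≋ρ : ∀ c → β c ≋ ρ c
  β≋ρ c n = β≈[<]ρ (suc n) c n ≤-refl

  -- Raising c and t adds 1 to the exponent of every level step and 2 to that of every down step,
  -- n + h in total, since a path from h to 0 has h more down steps than up steps.
  motzkin-raise : ∀ c t n h → motzkin (suc c) (suc t) n h ≗ (qpow· (n + h)) (motzkin c t n h)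
  motzkin-raise c t zero zero    d = refl
  motzkin-raise c t zero (suc h) d = sym (qpow-0ₚ (suc h) d)
  motzkin-raise c t (suc n) h d = begin
    (qpow· (h + suc c)) (motzkin (suc c) (suc t) n h) d + motzkin (suc c) (suc t) n (suc h) d
      + descent (suc c) (suc t) n h d
      ≡⟨ cong₂ _+_ (cong₂ _+_ (qpow-cong (h + suc c) (motzkin-raise c t n h) d)
                              (motzkin-raise c t n (suc h) d))
                   (descent-raise h d) ⟩
    (qpow· (h + suc c)) ((qpow· (n + h)) (motzkin c t n h)) d
      + (qpow· (n + suc h)) (motzkin c t n (suc h)) d + (qpow· E) (descent c t n h) d
      ≡⟨ cong₂ _+_ (cong₂ _+_ (qpow-qpow-exp (h + suc c) (n + h) E (h + c) (motzkin c t n h) level-exponents d)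
                              (qpow-exp (motzkin c t n (suc h)) (+-suc n h) d))
                   refl ⟩
    (qpow· E) ((qpow· (h + c)) (motzkin c t n h)) d + (qpow· E) (motzkin c t n (suc h)) d
      + (qpow· E) (descent c t n h) d
      ≡⟨ sym (trans (qpow-⊕ E ((qpow· (h + c)) (motzkin c t n h) ⊕ motzkin c t n (suc h)) (descent c t n h) d)
                    (cong (_+ (qpow· E) (descent c t n h) d)
                          (qpow-⊕ E ((qpow· (h + c)) (motzkin c t n h)) (motzkin c t n (suc h)) d))) ⟩
    (qpow· E) (motzkin c t (suc n) h) d ∎
    where
    open ≡-Reasoning
    E : ℕ
    E = suc n + h
    level-exponents : h + suc c + (n + h) ≡ E + (h + c)
    level-exponents = solve 3 (λ h c n → h :+ (con 1 :+ c) :+ (n :+ h) := con 1 :+ n :+ h :+ (h :+ c)) refl h c n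
    descent-raise : ∀ h → descent (suc c) (suc t) n h ≗ (qpow· (suc n + h)) (descent c t n h)
    descent-raise zero    e = sym (qpow-0ₚ (suc n + 0) e)
    descent-raise (suc g) e =
      trans (qpow-cong (g + suc c + suc t) (motzkin-raise c t n g) e)
            (qpow-qpow-exp (g + suc c + suc t) (n + g) (suc n + suc g) (g + c + t) (motzkin c t n g)
               (solve 4 (λ g c t n → g :+ (con 1 :+ c) :+ (con 1 :+ t) :+ (n :+ g)
                                   := con 1 :+ n :+ (con 1 :+ g) :+ (g :+ c :+ t)) refl g c t n) e)


module MotzkinRecurrence where

  open QPolynomial
  open MotzkinPaths
  open import Data.Nat using (_+_; _∸_; _<_)
  open import Data.Nat.Properties using (+-identityʳ; +-assoc; +-∸-assoc)
  open import Relation.Binary.PropositionalEquality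

  L : ℕ → Poly
  L n = motzkin 0 0 n 0

  tail-β₀ : tail (β 0) ≋ β 0 ⊞ X ⊠ (β 1 ⊠ β 0)
  tail-β₀ n d = trans (motzkinₛ-unfold 0 0 (suc n) d)
    (cong (β 0 n d +_) (trans (shift-qpow₀ n d) (sym (X-⊠ (β 1 ⊠ β 0) n d))))
    where
    shift-qpow₀ : ∀ n → shift (qpowₛ 0 (β 1 ⊠ β 0)) n ≗ shift (β 1 ⊠ β 0) n
    shift-qpow₀ zero    d = refl
    shift-qpow₀ (suc n) d = refl

  β₁⊠β₀ : β 1 ⊠ β 0 ≋ β 0 ⊞ Q 1 ⊠ X ⊠ (α 1 ⊠ tail (β 0))
  β₁⊠β₀ = S.≋-trans (S.⊠-congʳ (β 0) (β≋ρ 1)) (S.≋-trans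
    (solveₛ 5 (λ x q al be1 l → (conₑ 1 +ₑ q *ₑ x *ₑ al +ₑ q *ₑ x *ₑ x *ₑ al *ₑ be1) *ₑ l
                              =ₑ l +ₑ q *ₑ x *ₑ (al *ₑ (l +ₑ x *ₑ (be1 *ₑ l))))
              S.≋-refl X (Q 1) (α 1) (β 1) (β 0))
    (S.⊞-congˡ (β 0) (S.⊠-congˡ (Q 1 ⊠ X) (S.⊠-congˡ (α 1) (S.≋-sym tail-β₀)))))

  L-suc-suc : ∀ m → L (suc (suc m)) ≗ L (suc m) ⊕ (β 1 ⊠ β 0) m
  L-suc-suc m d = trans (tail-β₀ (suc m) d) (cong (L (suc m) d +_) (X-⊠ (β 1 ⊠ β 0) (suc m) d))

  Q₁-X-⊠ : ∀ g n → (Q 1 ⊠ X ⊠ g) n ≗ (qpow· 1) (shift g n)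
  Q₁-X-⊠ g n d = trans (S.⊠-assoc (Q 1) X g n d)
                       (trans (Q-⊠ 1 (X ⊠ g) n d) (qpow-cong 1 (X-⊠ g n) d))

  ⊠-as-Σ₁ : ∀ f g n → (f ⊠ g) n ≗ Σ₁ (suc n) (λ k → f (k ∸ 1) ⊠ₚ g (n ∸ (k ∸ 1)))
  ⊠-as-Σ₁ f g zero    d = refl
  ⊠-as-Σ₁ f g (suc n) d =
    trans (cong ((f 0 ⊠ₚ g (suc n)) d +_)
                (trans (⊠-as-Σ₁ (tail f) g n d) (Σ₁-cong-< (suc n) (λ _ _ _ → refl) d)))
          (sym (Σ₁-suc-front (suc n) (λ k → f (k ∸ 1) ⊠ₚ g (suc n ∸ (k ∸ 1))) d))

  α₁≗qpow-L : ∀ j → α 1 j ≗ (qpow· j) (L j)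
  α₁≗qpow-L j d = trans (motzkin-raise 0 0 j 0 d) (qpow-exp (L j) (+-identityʳ j) d)

  L-recurrence : ∀ m → L (suc (suc m)) ≗
    L (suc m) ⊕ L m ⊕ Σ₁ m (λ k → (qpow· k) (L (k ∸ 1) ⊛ L (suc (suc m) ∸ k ∸ 1)))
  L-recurrence zero d =
    trans (L-suc-suc 0 d) (trans (cong (L 1 d +_) (trans (β₁⊠β₀ 0 d) (cong (L 0 d +_)
      (trans (Q₁-X-⊠ (α 1 ⊠ tail (β 0)) 0 d) (qpow-0ₚ 1 d)))))
      (sym (+-assoc (L 1 d) (L 0 d) 0)))
  L-recurrence (suc m) d = begin
    L (3 + m) d
      ≡⟨ L-suc-suc (suc m) d ⟩
    L (2 + m) d + (β 1 ⊠ β 0) (suc m) d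
      ≡⟨ cong (L (2 + m) d +_) (β₁⊠β₀ (suc m) d) ⟩
    L (2 + m) d + (L (suc m) d + (Q 1 ⊠ X ⊠ (α 1 ⊠ tail (β 0))) (suc m) d)
      ≡⟨ cong (λ z → L (2 + m) d + (L (suc m) d + z)) (trans (Q₁-X-⊠ (α 1 ⊠ tail (β 0)) (suc m) d)
           (trans (qpow-cong 1 (⊠-as-Σ₁ (α 1) (tail (β 0)) m) d)
                  (trans (qpow-Σ₁ 1 (suc m) (λ k → α 1 (k ∸ 1) ⊠ₚ L (suc (m ∸ (k ∸ 1)))) d)
                         (Σ₁-cong-< (suc m) summand d)))) ⟩
    L (2 + m) d + (L (suc m) d + Σ₁ (suc m) (λ k → (qpow· k) (L (k ∸ 1) ⊛ L (3 + m ∸ k ∸ 1))) d)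
      ≡⟨ sym (+-assoc (L (2 + m) d) _ _) ⟩
    L (2 + m) d + L (suc m) d + Σ₁ (suc m) (λ k → (qpow· k) (L (k ∸ 1) ⊛ L (3 + m ∸ k ∸ 1))) d ∎
    where
    open ≡-Reasoning
    [2+m]∸j∸1≡1+[m∸j] : ∀ {j} → j ≤ m → 2 + m ∸ j ∸ 1 ≡ suc (m ∸ j)
    [2+m]∸j∸1≡1+[m∸j] j≤m = trans (cong (_∸ 1) (+-∸-assoc 1 (m≤n⇒m≤1+n j≤m))) (+-∸-assoc 1 j≤m)
    summand : ∀ j → j < suc m →
      (qpow· 1) (α 1 j ⊠ₚ L (suc (m ∸ j))) ≗ (qpow· (suc j)) (L j ⊛ L (3 + m ∸ suc j ∸ 1))
    summand j (s≤s j≤m) e = begin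
      (qpow· 1) (α 1 j ⊠ₚ L (suc (m ∸ j))) e
        ≡⟨ qpow-cong 1 (P.⊠-congʳ (L (suc (m ∸ j))) (α₁≗qpow-L j)) e ⟩
      (qpow· 1) ((qpow· j) (L j) ⊠ₚ L (suc (m ∸ j))) e
        ≡⟨ qpow-cong 1 (λ e′ → sym (qpow-⊠ₚ j (L j) (L (suc (m ∸ j))) e′)) e ⟩
      (qpow· 1) ((qpow· j) (L j ⊠ₚ L (suc (m ∸ j)))) e
        ≡⟨ qpow-+ 1 j (L j ⊠ₚ L (suc (m ∸ j))) e ⟩
      (qpow· (suc j)) (L j ⊠ₚ L (suc (m ∸ j))) e
        ≡⟨ qpow-cong (suc j) (λ e′ → sym (⊛≗⊠ₚ (L j) (L (suc (m ∸ j))) e′)) e ⟩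
      (qpow· (suc j)) (L j ⊛ L (suc (m ∸ j))) e
        ≡⟨ cong (λ i → (qpow· (suc j)) (L j ⊛ L i) e) (sym ([2+m]∸j∸1≡1+[m∸j] j≤m)) ⟩
      (qpow· (suc j)) (L j ⊛ L (2 + m ∸ j ∸ 1)) e ∎


module JumpPaths where

  open QPolynomial
  open MotzkinPaths using (motzkin)
  open MotzkinRecurrence using (L)
  open import Data.Nat using (_+_; _∸_; _<_; _<ᵇ_; _≡ᵇ_)
  open import Data.Nat.Properties
    using (+-identityʳ; +-comm; +-suc; m+[n∸m]≡n; ∸-+-assoc; +-∸-assoc; ≤-trans; m≤m+n; +-commutativeSemigroup;
           <⇒<ᵇ; <ᵇ⇒<; ≡ᵇ⇒≡; ≡⇒≡ᵇ; <⇒≱; <-irrefl; n<1+n; ≤-reflexive; m≤n+m; +-monoʳ-<)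
  open import Data.Bool using (Bool; _∧_; not; if_then_else_)
  open import Data.Bool.Properties using (∧-zeroʳ)
  open import Algebra.Properties.CommutativeSemigroup +-commutativeSemigroup using (interchange)
  open import Relation.Binary.PropositionalEquality
  open import Data.Nat.Solver using (module +-*-Solver)
  open +-*-Solver using (solve; _:=_; _:+_; con)

  -- Paths on ℕ with up steps of weight 1 and jumps from j down to any r < j of weight q^r.
  jump : ℕ → ℕ → Poly
  jump j zero    = one
  jump j (suc n) = jump (suc j) n ⊕ Σ< j (λ r → (qpow· r) (jump r n))

  -- motzkinUp j h n weighs the Motzkin paths (c = t = 0) of length j + n from height h to 0
  -- whose first j steps are level or up steps.
  motzkinUp : ℕ → ℕ → ℕ → Poly
  motzkinUp zero    h n = motzkin 0 0 n h
  motzkinUp (suc j) h n = (qpow· h) (motzkinUp j h n) ⊕ motzkinUp j (suc h) n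

  -- the paths counted by motzkinUp j h (suc n) whose (j + 1)-st step is a down step
  downAfter : ℕ → ℕ → ℕ → Poly
  downAfter j zero    n = Σ< j (λ r → (qpow· r) (motzkinUp r 0 n))
  downAfter j (suc g) n = (qpow· (g + j)) (motzkinUp j g n)

  motzkinUp-suc : ∀ j h n → motzkinUp j h (suc n) ≗ motzkinUp (suc j) h n ⊕ downAfter j h n
  motzkinUp-suc zero zero    n d = refl
  motzkinUp-suc zero (suc g) n d =
    cong₂ _+_ (cong (_+ motzkin 0 0 n (suc (suc g)) d) (qpow-exp (motzkin 0 0 n (suc g)) (+-identityʳ (suc g)) d))
              (qpow-exp (motzkin 0 0 n g) (+-identityʳ (g + 0)) d)
  motzkinUp-suc (suc j) zero n d =
    trans (cong₂ _+_ (motzkinUp-suc j 0 n d) (motzkinUp-suc j 1 n d))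
    (trans (interchange (motzkinUp (suc j) 0 n d) (downAfter j 0 n d) (motzkinUp (suc j) 1 n d) (downAfter j 1 n d))
           (cong ((motzkinUp (suc j) 0 n d + motzkinUp (suc j) 1 n d) +_)
                 (sym (Σ<-suc j (λ r → (qpow· r) (motzkinUp r 0 n)) d))))
  motzkinUp-suc (suc j) (suc g) n d = begin
    (qpow· (suc g)) (motzkinUp j (suc g) (suc n)) d + motzkinUp j (suc (suc g)) (suc n) d
      ≡⟨ cong₂ _+_ (qpow-cong (suc g) (motzkinUp-suc j (suc g) n) d) (motzkinUp-suc j (suc (suc g)) n d) ⟩
    (qpow· (suc g)) (motzkinUp (suc j) (suc g) n ⊕ (qpow· (g + j)) (motzkinUp j g n)) d + (C d + E d)
      ≡⟨ cong (_+ (C d + E d))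
           (trans (qpow-⊕ (suc g) (motzkinUp (suc j) (suc g) n) ((qpow· (g + j)) (motzkinUp j g n)) d)
                  (cong (A d +_) (qpow-qpow-exp (suc g) (g + j) (g + suc j) g (motzkinUp j g n) exponents d))) ⟩
    (A d + B d) + (C d + E d)
      ≡⟨ interchange (A d) (B d) (C d) (E d) ⟩
    (A d + C d) + (B d + E d)
      ≡⟨ cong ((A d + C d) +_)
           (sym (trans (qpow-⊕ (g + suc j) ((qpow· g) (motzkinUp j g n)) (motzkinUp j (suc g) n) d)
                       (cong (B d +_) (qpow-exp (motzkinUp j (suc g) n) (+-suc g j) d)))) ⟩
    (A d + C d) + (qpow· (g + suc j)) (motzkinUp (suc j) g n) d ∎
    where
    open ≡-Reasoning
    A B C E : Poly
    A = (qpow· (suc g)) (motzkinUp (suc j) (suc g) n)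
    B = (qpow· (g + suc j)) ((qpow· g) (motzkinUp j g n))
    C = motzkinUp (suc j) (suc (suc g)) n
    E = (qpow· (suc g + j)) (motzkinUp j (suc g) n)
    exponents : suc g + (g + j) ≡ g + suc j + g
    exponents = solve 2 (λ g j → con 1 :+ g :+ (g :+ j) := g :+ (con 1 :+ j) :+ g) refl g j

  jump≗motzkinUp : ∀ j n → jump j n ≗ motzkinUp j 0 n
  jump≗motzkinUp j zero d = sym (motzkinUp-0 j d)
    where
    motzkinUp-suc-0 : ∀ j g → motzkinUp j (suc g) 0 ≗ 0ₚ
    motzkinUp-suc-0 zero    g d = refl
    motzkinUp-suc-0 (suc j) g d =
      cong₂ _+_ (trans (qpow-cong (suc g) (motzkinUp-suc-0 j g) d) (qpow-0ₚ (suc g) d)) (motzkinUp-suc-0 j (suc g) d)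
    motzkinUp-0 : ∀ j → motzkinUp j 0 0 ≗ one
    motzkinUp-0 zero    d = refl
    motzkinUp-0 (suc j) d = trans (cong₂ _+_ (motzkinUp-0 j d) (motzkinUp-suc-0 j 0 d)) (+-identityʳ _)
  jump≗motzkinUp j (suc n) d =
    trans (cong₂ _+_ (jump≗motzkinUp (suc j) n d)
                     (Σ<-cong j (λ r → qpow-cong r (jump≗motzkinUp r n)) d))
          (sym (motzkinUp-suc j 0 n d))

  jump₀≗L : ∀ n → jump 0 n ≗ L n
  jump₀≗L = jump≗motzkinUp 0

  admissible : ℕ → ℕ → ℕ → Bool
  admissible m e a = (a <ᵇ suc m) ∧ not (a <ᵇ e)

  -- continuations k m e n weighs the continuations of length n, in the letters 1, …, k, of a good
  -- word with largest letter m whose letters 1, …, e are exhausted; the next letter is a + 1.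
  mutual
    continuations : ℕ → ℕ → ℕ → ℕ → Poly
    continuations k m e zero    = one
    continuations k m e (suc n) = Σ< k (continuationsBy k m e n)

    continuationsBy : ℕ → ℕ → ℕ → ℕ → ℕ → Poly
    continuationsBy k m e n a =
      if admissible m e a
      then (if a ≡ᵇ m then continuations k (suc m) e n
            else (qpow· (m ∸ suc a)) (continuations k m (suc a) n))
      else 0ₚ

  continuationsBy-< : ∀ k m e n a → a < e → continuationsBy k m e n a ≗ 0ₚ
  continuationsBy-< k m e n a a<e d rewrite T⇒≡true (<⇒<ᵇ a<e) | ∧-zeroʳ (a <ᵇ suc m) = refl

  continuationsBy-> : ∀ k m e n a → m < a → continuationsBy k m e n a ≗ 0ₚ
  continuationsBy-> k m e n a m<a d rewrite ¬T⇒≡false (λ t → <⇒≱ (<ᵇ⇒< a (suc m) t) m<a) = refl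

  continuationsBy-repeat : ∀ k m e n a → e ≤ a → a < m →
    continuationsBy k m e n a ≗ (qpow· (m ∸ suc a)) (continuations k m (suc a) n)
  continuationsBy-repeat k m e n a e≤a a<m d
    rewrite T⇒≡true (<⇒<ᵇ (m≤n⇒m≤1+n a<m)) | ¬T⇒≡false (λ t → <⇒≱ (<ᵇ⇒< a e t) e≤a)
          | ¬T⇒≡false (λ t → <-irrefl (≡ᵇ⇒≡ a m t) a<m) = refl

  continuationsBy-new : ∀ k m e n → e ≤ m → continuationsBy k m e n m ≗ continuations k (suc m) e n
  continuationsBy-new k m e n e≤m d
    rewrite T⇒≡true (<⇒<ᵇ (n<1+n m)) | ¬T⇒≡false (λ t → <⇒≱ (<ᵇ⇒< m e t) e≤m)
          | T⇒≡true (≡⇒≡ᵇ m m refl) = refl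

  continuations≗jump : ∀ n k m e → e ≤ m → m + n ≤ k → continuations k m e n ≗ jump (m ∸ e) n
  continuations≗jump zero    k m e e≤m m+n≤k d = refl
  continuations≗jump (suc n) k m e e≤m m+1+n≤k d = begin
    Σ< k by d
      ≡⟨ Σ<-truncate (suc m) k by (≤-trans (s≤s (m≤m+n m n)) (≤-trans (≤-reflexive (sym (+-suc m n))) m+1+n≤k))
                     (continuationsBy-> k m e n) d ⟩
    Σ< (suc m) by d
      ≡⟨ Σ<-suc m by d ⟩
    Σ< m by d + by m d
      ≡⟨ cong₂ _+_ repeats new ⟩
    Σ< j F d + jump (suc j) n d
      ≡⟨ +-comm (Σ< j F d) _ ⟩
    jump j (suc n) d ∎
    where
    open ≡-Reasoning
    by : ℕ → Poly
    by = continuationsBy k m e n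
    j : ℕ
    j = m ∸ e
    F : ℕ → Poly
    F r = (qpow· r) (jump r n)
    m+n≤k : m + n ≤ k
    m+n≤k = ≤-trans (m≤n+m (m + n) 1) (≤-trans (≤-reflexive (sym (+-suc m n))) m+1+n≤k)
    repeat : ∀ i → i < j → by (e + i) ≗ F (j ∸ suc i)
    repeat i i<j d′ = begin
      by (e + i) d′
        ≡⟨ continuationsBy-repeat k m e n (e + i) (m≤m+n e i) e+i<m d′ ⟩
      (qpow· (m ∸ suc (e + i))) (continuations k m (suc (e + i)) n) d′
        ≡⟨ qpow-cong (m ∸ suc (e + i)) (continuations≗jump n k m (suc (e + i)) e+i<m m+n≤k) d′ ⟩
      F (m ∸ suc (e + i)) d′
        ≡⟨ cong (λ r → F r d′) (trans (cong (m ∸_) (sym (+-suc e i))) (sym (∸-+-assoc m e (suc i)))) ⟩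
      F (j ∸ suc i) d′ ∎
      where
      e+i<m : e + i < m
      e+i<m = subst (e + i <_) (m+[n∸m]≡n e≤m) (+-monoʳ-< e i<j)
    repeats : Σ< m by d ≡ Σ< j F d
    repeats = begin
      Σ< m by d
        ≡⟨ cong (λ x → Σ< x by d) (sym (m+[n∸m]≡n e≤m)) ⟩
      Σ< (e + j) by d
        ≡⟨ Σ<-+ e j by d ⟩
      Σ< e by d + Σ< j (λ i → by (e + i)) d
        ≡⟨ cong₂ _+_ (Σ<-zero e by (continuationsBy-< k m e n) d) (Σ<-cong-< j repeat d) ⟩
      Σ< j (λ i → F (j ∸ suc i)) d
        ≡⟨ Σ<-reverse j F d ⟩
      Σ< j F d ∎
    new : by m d ≡ jump (suc j) n d
    new = trans (continuationsBy-new k m e n e≤m d)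
          (trans (continuations≗jump n k (suc m) e (m≤n⇒m≤1+n e≤m)
                                     (≤-trans (≤-reflexive (sym (+-suc m n))) m+1+n≤k) d)
                 (cong (λ r → jump r n d) (+-∸-assoc 1 e≤m)))


v111 v1221 : Word
v111  = 1 ∷ 1 ∷ 1 ∷ []
v1221 = 1 ∷ 2 ∷ 2 ∷ 1 ∷ []


module Subwords where

  open import Data.Nat using (_≡ᵇ_; _<ᵇ_)
  open import Data.Nat.Properties using (≡ᵇ⇒≡)
  open import Data.Bool using (Bool; true; false; _∧_; _∨_; T)
  open import Data.Bool.Properties
    using (∨-assoc; ∨-zeroʳ; ∧-zeroʳ; ∧-comm; ∧-identityʳ; ∧-assoc; ∨-commutativeMonoid; T-∨; T-∧)
  open import Data.Product using (proj₁; proj₂)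
  open import Data.Sum using (inj₁; inj₂)
  open import Function using (_∘_; case_of_)
  open import Function.Bundles using (Equivalence)
  open import Algebra.Bundles using (CommutativeMonoid)
  open import Algebra.Properties.CommutativeSemigroup (CommutativeMonoid.commutativeSemigroup ∨-commutativeMonoid)
    using () renaming (interchange to ∨-interchange)
  open import Data.Bool.ListAction using (any)
  open import Data.Bool.Solver using (module ∨-∧-Solver)
  open ∨-∧-Solver using (solve; _:=_; con) renaming (_:+_ to _:∨_; _:*_ to _:∧_)
  open import Data.List using (List; []; _∷_; map; _++_; _∷ʳ_)
  open import Relation.Binary.PropositionalEquality

  any-++ : ∀ {A : Set} (g : A → Bool) xs ys → any g (xs ++ ys) ≡ any g xs ∨ any g ys
  any-++ g []       ys = refl
  any-++ g (x ∷ xs) ys = trans (cong (g x ∨_) (any-++ g xs ys)) (sym (∨-assoc (g x) _ _))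

  any-map : ∀ {A B : Set} (g : B → Bool) (f : A → B) xs → any g (map f xs) ≡ any (g ∘ f) xs
  any-map g f []       = refl
  any-map g f (x ∷ xs) = cong (g (f x) ∨_) (any-map g f xs)

  any-cong : ∀ {A : Set} {g g′ : A → Bool} xs → (∀ u → g u ≡ g′ u) → any g xs ≡ any g′ xs
  any-cong []       e = refl
  any-cong (x ∷ xs) e = cong₂ _∨_ (e x) (any-cong xs e)

  any-∧ˡ : ∀ {A : Set} c (g : A → Bool) xs → any (λ u → c ∧ g u) xs ≡ c ∧ any g xs
  any-∧ˡ true  g xs       = refl
  any-∧ˡ false g []       = refl
  any-∧ˡ false g (x ∷ xs) = any-∧ˡ false g xs

  any-∧ʳ : ∀ {A : Set} c (g : A → Bool) xs → any (λ u → g u ∧ c) xs ≡ any g xs ∧ c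
  any-∧ʳ c g xs = trans (any-cong xs (λ u → ∧-comm (g u) c)) (trans (any-∧ˡ c g xs) (∧-comm c (any g xs)))

  anySubword : (Word → Bool) → Word → Bool
  anySubword g p = any g (subwords p)

  anySubword-∷ʳ : ∀ g p x → anySubword g (p ∷ʳ x) ≡ anySubword g p ∨ anySubword (λ u → g (u ∷ʳ x)) p
  anySubword-∷ʳ g []       x =
    solve 2 (λ a b → a :∨ (b :∨ con false) := (b :∨ con false) :∨ (a :∨ con false)) refl (g (x ∷ [])) (g [])
  anySubword-∷ʳ g (y ∷ p) x = begin
    any g (map (y ∷_) (subwords (p ∷ʳ x)) ++ subwords (p ∷ʳ x))
      ≡⟨ split g (subwords (p ∷ʳ x)) ⟩
    anySubword (g ∘ (y ∷_)) (p ∷ʳ x) ∨ anySubword g (p ∷ʳ x)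
      ≡⟨ cong₂ _∨_ (anySubword-∷ʳ (g ∘ (y ∷_)) p x) (anySubword-∷ʳ g p x) ⟩
    (anySubword (g ∘ (y ∷_)) p ∨ anySubword (λ u → g (y ∷ u ∷ʳ x)) p) ∨
      (anySubword g p ∨ anySubword (λ u → g (u ∷ʳ x)) p)
      ≡⟨ ∨-interchange (anySubword (g ∘ (y ∷_)) p) (anySubword (λ u → g (y ∷ u ∷ʳ x)) p)
                       (anySubword g p) (anySubword (λ u → g (u ∷ʳ x)) p) ⟩
    (anySubword (g ∘ (y ∷_)) p ∨ anySubword g p) ∨
      (anySubword (λ u → g (y ∷ u ∷ʳ x)) p ∨ anySubword (λ u → g (u ∷ʳ x)) p)
      ≡⟨ sym (cong₂ _∨_ (split g (subwords p)) (split (λ u → g (u ∷ʳ x)) (subwords p))) ⟩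
    anySubword g (y ∷ p) ∨ anySubword (λ u → g (u ∷ʳ x)) (y ∷ p) ∎
    where
    open ≡-Reasoning
    split : ∀ g s → any g (map (y ∷_) s ++ s) ≡ any (g ∘ (y ∷_)) s ∨ any g s
    split g s = trans (any-++ g (map (y ∷_) s) s) (cong (_∨ any g s) (any-map g (y ∷_) s))

  anySubword-∷ : ∀ g y p → anySubword g (y ∷ p) ≡ anySubword (g ∘ (y ∷_)) p ∨ anySubword g p
  anySubword-∷ g y p = trans (any-++ g (map (y ∷_) (subwords p)) (subwords p))
                             (cong (_∨ anySubword g p) (any-map g (y ∷_) (subwords p)))

  ∷ʳ-==-[] : ∀ u x → ((u ∷ʳ x) == []) ≡ false
  ∷ʳ-==-[] []      x = refl
  ∷ʳ-==-[] (_ ∷ _) x = refl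

  []-==-∷ʳ : ∀ u x → ([] == (u ∷ʳ x)) ≡ false
  []-==-∷ʳ []      x = refl
  []-==-∷ʳ (_ ∷ _) x = refl

  ∷ʳ-== : ∀ u v x z → ((u ∷ʳ x) == (v ∷ʳ z)) ≡ (u == v) ∧ (x ≡ᵇ z)
  ∷ʳ-== []      []      x z = ∧-identityʳ (x ≡ᵇ z)
  ∷ʳ-== []      (b ∷ v) x z = trans (cong ((x ≡ᵇ b) ∧_) ([]-==-∷ʳ v z)) (∧-zeroʳ (x ≡ᵇ b))
  ∷ʳ-== (a ∷ u) []      x z = trans (cong ((a ≡ᵇ z) ∧_) (∷ʳ-==-[] u x)) (∧-zeroʳ (a ≡ᵇ z))
  ∷ʳ-== (a ∷ u) (b ∷ v) x z = trans (cong ((a ≡ᵇ b) ∧_) (∷ʳ-== u v x z)) (sym (∧-assoc (a ≡ᵇ b) _ _))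

  anySubword-==[] : ∀ p → anySubword (_== []) p ≡ true
  anySubword-==[] []      = refl
  anySubword-==[] (y ∷ p) =
    trans (anySubword-∷ (_== []) y p)
          (trans (cong (anySubword (λ u → (y ∷ u) == []) p ∨_) (anySubword-==[] p)) (∨-zeroʳ _))

  occurs : ℕ → Word → Bool
  occurs y = anySubword (_== (y ∷ []))

  occurs₂ : ℕ → ℕ → Word → Bool
  occurs₂ y z = anySubword (_== (y ∷ z ∷ []))

  twice : ℕ → Word → Bool
  twice y = occurs₂ y y

  -- isXYY x u: u is x y y for some y > x, i.e. u ∷ʳ x is an occurrence of 1221
  isXYY : ℕ → Word → Bool
  isXYY x (a ∷ b ∷ c ∷ []) = (a ≡ᵇ x) ∧ ((b ≡ᵇ c) ∧ (x <ᵇ b))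
  isXYY x _                = false

  hasXYY : ℕ → Word → Bool
  hasXYY x = anySubword (isXYY x)

  occurs-∷ʳ : ∀ y p x → occurs y (p ∷ʳ x) ≡ occurs y p ∨ (x ≡ᵇ y)
  occurs-∷ʳ y p x = trans (anySubword-∷ʳ _ p x) (cong (occurs y p ∨_)
    (trans (any-cong (subwords p) (λ u → ∷ʳ-== u [] x y))
    (trans (any-∧ʳ (x ≡ᵇ y) (_== []) (subwords p)) (cong (_∧ (x ≡ᵇ y)) (anySubword-==[] p)))))

  occurs₂-∷ʳ : ∀ y z p x → occurs₂ y z (p ∷ʳ x) ≡ occurs₂ y z p ∨ (occurs y p ∧ (x ≡ᵇ z))
  occurs₂-∷ʳ y z p x = trans (anySubword-∷ʳ _ p x) (cong (occurs₂ y z p ∨_)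
    (trans (any-cong (subwords p) (λ u → ∷ʳ-== u (y ∷ []) x z)) (any-∧ʳ (x ≡ᵇ z) (_== (y ∷ [])) (subwords p))))

  ≡ᵇ-∧-subst : ∀ b z (f : ℕ → Bool) → (b ≡ᵇ z) ∧ f b ≡ (b ≡ᵇ z) ∧ f z
  ≡ᵇ-∧-subst b z f with b ≡ᵇ z in eq
  ... | true  = cong f (≡ᵇ⇒≡ b z (≡true⇒T eq))
  ... | false = refl

  ∧-zeroʳ³ : ∀ p q r → false ≡ p ∧ (q ∧ (r ∧ false))
  ∧-zeroʳ³ = solve 3 (λ p q r → con false := p :∧ (q :∧ (r :∧ con false))) refl

  isXYY-∷ʳ : ∀ y u z → isXYY y (u ∷ʳ z) ≡ (y <ᵇ z) ∧ (u == (y ∷ z ∷ []))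
  isXYY-∷ʳ y []              z = sym (∧-zeroʳ (y <ᵇ z))
  isXYY-∷ʳ y (a ∷ [])        z = sym (trans (cong ((y <ᵇ z) ∧_) (∧-zeroʳ (a ≡ᵇ y))) (∧-zeroʳ (y <ᵇ z)))
  isXYY-∷ʳ y (a ∷ b ∷ [])    z = begin
    (a ≡ᵇ y) ∧ ((b ≡ᵇ z) ∧ (y <ᵇ b))
      ≡⟨ cong ((a ≡ᵇ y) ∧_) (≡ᵇ-∧-subst b z (y <ᵇ_)) ⟩
    (a ≡ᵇ y) ∧ ((b ≡ᵇ z) ∧ (y <ᵇ z))
      ≡⟨ solve 3 (λ a b c → a :∧ (b :∧ c) := c :∧ (a :∧ (b :∧ con true))) refl (a ≡ᵇ y) (b ≡ᵇ z) (y <ᵇ z) ⟩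
    (y <ᵇ z) ∧ ((a ≡ᵇ y) ∧ ((b ≡ᵇ z) ∧ true)) ∎
    where open ≡-Reasoning
  isXYY-∷ʳ y (a ∷ b ∷ c ∷ [])    z = ∧-zeroʳ³ (y <ᵇ z) (a ≡ᵇ y) (b ≡ᵇ z)
  isXYY-∷ʳ y (a ∷ b ∷ c ∷ _ ∷ _) z = ∧-zeroʳ³ (y <ᵇ z) (a ≡ᵇ y) (b ≡ᵇ z)

  hasXYY-∷ʳ : ∀ y p x → hasXYY y (p ∷ʳ x) ≡ hasXYY y p ∨ ((y <ᵇ x) ∧ occurs₂ y x p)
  hasXYY-∷ʳ y p x = trans (anySubword-∷ʳ (isXYY y) p x) (cong (hasXYY y p ∨_)
    (trans (any-cong (subwords p) (λ u → isXYY-∷ʳ y u x)) (any-∧ˡ (y <ᵇ x) (_== (y ∷ x ∷ [])) (subwords p))))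

  occurs-∷ : ∀ z a p → occurs z (a ∷ p) ≡ (a ≡ᵇ z) ∨ occurs z p
  occurs-∷ z a p = trans (anySubword-∷ _ a p) (cong (_∨ occurs z p)
    (trans (any-∧ˡ (a ≡ᵇ z) (_== []) (subwords p)) (trans (cong ((a ≡ᵇ z) ∧_) (anySubword-==[] p)) (∧-identityʳ _))))

  occurs₂-∷ : ∀ y z a p → occurs₂ y z (a ∷ p) ≡ ((a ≡ᵇ y) ∧ occurs z p) ∨ occurs₂ y z p
  occurs₂-∷ y z a p =
    trans (anySubword-∷ _ a p) (cong (_∨ occurs₂ y z p) (any-∧ˡ (a ≡ᵇ y) (_== (z ∷ [])) (subwords p)))

  occurs₂⇒occursʳ : ∀ y z p → occurs₂ y z p ≡ true → occurs z p ≡ true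
  occurs₂⇒occursʳ y z (a ∷ p) t = T⇒≡true (subst T (sym (occurs-∷ z a p)) (Equivalence.from T-∨ (inj₂ (case
    Equivalence.to T-∨ (subst T (occurs₂-∷ y z a p) (≡true⇒T t)) of λ where
      (inj₁ t₁) → proj₂ (Equivalence.to T-∧ t₁)
      (inj₂ t₂) → ≡true⇒T (occurs₂⇒occursʳ y z p (T⇒≡true t₂))))))

  occurs₂⇒occursˡ : ∀ y z p → occurs₂ y z p ≡ true → occurs y p ≡ true
  occurs₂⇒occursˡ y z (a ∷ p) t = T⇒≡true (subst T (sym (occurs-∷ y a p)) (Equivalence.from T-∨ (case
    Equivalence.to T-∨ (subst T (occurs₂-∷ y z a p) (≡true⇒T t)) of λ where
      (inj₁ t₁) → inj₁ (proj₁ (Equivalence.to T-∧ t₁))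
      (inj₂ t₂) → inj₂ (≡true⇒T (occurs₂⇒occursˡ y z p (T⇒≡true t₂))))))


module Standardization where

  open Subwords using (isXYY)
  open import Data.Nat using (_<_; _≡ᵇ_; _<ᵇ_)
  open import Data.Nat.Properties
    using (≡ᵇ⇒≡; <ᵇ⇒<; <⇒<ᵇ; <-irrefl; <-trans; <-asym; <-cmp; ≮⇒≥; n≤1+n; ≤-trans; suc-injective;
           m≤n⇒m<n∨m≡n; +-comm)
  open import Data.Sum using (inj₁; inj₂)
  open import Data.Bool using (Bool; true; false; _∧_; _∨_; T; T?; if_then_else_)
  open import Data.Bool.Properties using (∨-zeroʳ; ∨-identityʳ; ∧-zeroʳ; ⇔→≡)
  open import Data.List using (List; []; _∷_; length; filter; _∷ʳ_)
  open import Data.List.Properties using (length-map; length-++)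
  open import Data.Product using (_×_; _,_)
  open import Function using (_∘_)
  open import Function.Bundles using (mk⇔)
  open import Relation.Binary using (tri<; tri≈; tri>)
  open import Relation.Binary.PropositionalEquality

  elem-∷ : ∀ z y l → elemᵇ z l ≡ true → elemᵇ z (y ∷ l) ≡ true
  elem-∷ z y l e = trans (cong ((z ≡ᵇ y) ∨_) e) (∨-zeroʳ _)

  elem-here : ∀ a l → elemᵇ a (a ∷ l) ≡ true
  elem-here a l = cong (_∨ elemᵇ a l) (≡ᵇ-refl a)

  elem-distinct : ∀ z w → elemᵇ z w ≡ true → elemᵇ z (distinct w) ≡ true
  elem-distinct z (x ∷ xs) e with z ≡ᵇ x in z≡x | elemᵇ x (distinct xs) in x∈
  ... | true  | true  rewrite ≡ᵇ-true⇒≡ z x z≡x = x∈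
  ... | true  | false = cong (_∨ elemᵇ z (distinct xs)) z≡x
  ... | false | true  = elem-distinct z xs e
  ... | false | false = elem-∷ z x (distinct xs) (elem-distinct z xs e)

  distinct-∷-∈ : ∀ y w → elemᵇ y w ≡ true → distinct (y ∷ w) ≡ distinct w
  distinct-∷-∈ y w y∈ rewrite elem-distinct y w y∈ = refl

  distinct-∷-∉ : ∀ y w → elemᵇ y (distinct w) ≡ false → distinct (y ∷ w) ≡ y ∷ distinct w
  distinct-∷-∉ y w y∉ rewrite y∉ = refl

  countBelow : ℕ → List ℕ → ℕ
  countBelow y D = length (filter (λ v → T? (v <ᵇ y)) D)

  countBelow-∷ : ∀ y d D → countBelow y (d ∷ D) ≡ (if d <ᵇ y then suc (countBelow y D) else countBelow y D)
  countBelow-∷ y d D with d <ᵇ y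
  ... | true  = refl
  ... | false = refl

  countBelow≡0 : ∀ y D → countBelow y D ≡ 0 → ∀ z → elemᵇ z D ≡ true → y ≤ z
  countBelow≡0 y (d ∷ D) c z z∈ with d <ᵇ y in d<y
  ... | false with z ≡ᵇ d in z≡d
  ...   | true  rewrite ≡ᵇ-true⇒≡ z d z≡d = ≮⇒≥ (λ d<y′ → subst T d<y (<⇒<ᵇ d<y′))
  ...   | false = countBelow≡0 y D c z z∈

  countBelow-mono : ∀ y z D → y < z → countBelow y D ≤ countBelow z D
  countBelow-mono y z []      y<z = z≤n
  countBelow-mono y z (d ∷ D) y<z rewrite countBelow-∷ y d D | countBelow-∷ z d D
    with d <ᵇ y in d<y | d <ᵇ z in d<z
  ... | true  | true  = s≤s (countBelow-mono y z D y<z)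
  ... | true  | false = ⊥-elim (subst T d<z (<⇒<ᵇ (<-trans (<ᵇ⇒< d y (≡true⇒T d<y)) y<z)))
  ... | false | true  = m≤n⇒m≤1+n (countBelow-mono y z D y<z)
  ... | false | false = countBelow-mono y z D y<z

  countBelow-strict : ∀ y z D → y < z → elemᵇ y D ≡ true → suc (countBelow y D) ≤ countBelow z D
  countBelow-strict y z (d ∷ D) y<z y∈ rewrite countBelow-∷ y d D | countBelow-∷ z d D
    with d <ᵇ y in d<y | d <ᵇ z in d<z | y ≡ᵇ d in y≡d
  ... | true  | false | _     = ⊥-elim (subst T d<z (<⇒<ᵇ (<-trans (<ᵇ⇒< d y (≡true⇒T d<y)) y<z)))
  ... | true  | true  | true  = ⊥-elim (<-irrefl (sym (≡ᵇ-true⇒≡ y d y≡d)) (<ᵇ⇒< d y (≡true⇒T d<y)))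
  ... | true  | true  | false = s≤s (countBelow-strict y z D y<z y∈)
  ... | false | true  | true  = s≤s (countBelow-mono y z D y<z)
  ... | false | true  | false = ≤-trans (countBelow-strict y z D y<z y∈) (n≤1+n _)
  ... | false | false | true  rewrite ≡ᵇ-true⇒≡ y d y≡d = ⊥-elim (subst T d<z (<⇒<ᵇ y<z))
  ... | false | false | false = countBelow-strict y z D y<z y∈

  rank≡1⇒≤ : ∀ w y → rank w y ≡ 1 → ∀ z → elemᵇ z w ≡ true → y ≤ z
  rank≡1⇒≤ w y r z z∈ = countBelow≡0 y (distinct w) (suc-injective r) z (elem-distinct z w z∈)

  rank-strict : ∀ w y z → y < z → elemᵇ y w ≡ true → rank w y < rank w z
  rank-strict w y z y<z y∈ = s≤s (countBelow-strict y z (distinct w) y<z (elem-distinct y w y∈))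

  rank-injective : ∀ w y z → elemᵇ y w ≡ true → elemᵇ z w ≡ true → rank w y ≡ rank w z → y ≡ z
  rank-injective w y z y∈ z∈ r with <-cmp y z
  ... | tri< y<z _ _ = ⊥-elim (<-irrefl r (rank-strict w y z y<z y∈))
  ... | tri≈ _ y≡z _ = y≡z
  ... | tri> _ _ z<y = ⊥-elim (<-irrefl (sym r) (rank-strict w z y z<y z∈))

  ==-refl : ∀ u → (u == u) ≡ true
  ==-refl []      = refl
  ==-refl (a ∷ u) = trans (cong (_∧ (u == u)) (≡ᵇ-refl a)) (==-refl u)

  ==-length : ∀ u v → length u ≢ length v → (u == v) ≡ false
  ==-length []      []      ≢ = ⊥-elim (≢ refl)
  ==-length []      (_ ∷ _) _ = refl
  ==-length (_ ∷ _) []      _ = refl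
  ==-length (a ∷ u) (b ∷ v) ≢ = trans (cong ((a ≡ᵇ b) ∧_) (==-length u v (≢ ∘ cong suc))) (∧-zeroʳ _)

  length-standardize-∷ʳ : ∀ u x → length (standardize (u ∷ʳ x)) ≡ suc (length u)
  length-standardize-∷ʳ u x =
    trans (length-map (rank (u ∷ʳ x)) (u ∷ʳ x)) (trans (length-++ u) (+-comm (length u) 1))

  standardize-∷ʳ-==-length : ∀ u x p → suc (length u) ≢ length p → (standardize (u ∷ʳ x) == p) ≡ false
  standardize-∷ʳ-==-length u x p ≢ =
    ==-length (standardize (u ∷ʳ x)) p (≢ ∘ trans (sym (length-standardize-∷ʳ u x)))

  rank-xxx : ∀ x → rank (x ∷ x ∷ x ∷ []) x ≡ 1
  rank-xxx x rewrite distinct-∷-∈ x (x ∷ x ∷ []) (elem-here x (x ∷ []))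
                   | distinct-∷-∈ x (x ∷ []) (elem-here x []) | <ᵇ-irrefl x = refl

  x∈abx : ∀ a b x → elemᵇ x (a ∷ b ∷ x ∷ []) ≡ true
  x∈abx a b x = elem-∷ x a (b ∷ x ∷ []) (elem-∷ x b (x ∷ []) (elem-here x []))

  standardize-111-forward : ∀ a b x → let r = rank (a ∷ b ∷ x ∷ []) in
    ((r a ≡ᵇ 1) ∧ ((r b ≡ᵇ 1) ∧ ((r x ≡ᵇ 1) ∧ true))) ≡ true → ((a ∷ b ∷ []) == (x ∷ x ∷ [])) ≡ true
  standardize-111-forward a b x h
    with (ra , h₁) ← ∧-true (rank (a ∷ b ∷ x ∷ []) a ≡ᵇ 1) _ h
    with (rb , h₂) ← ∧-true (rank (a ∷ b ∷ x ∷ []) b ≡ᵇ 1) _ h₁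
    with (rx , _)  ← ∧-true (rank (a ∷ b ∷ x ∷ []) x ≡ᵇ 1) _ h₂
    = subst₂ (λ a b → ((a ∷ b ∷ []) == (x ∷ x ∷ [])) ≡ true)
             (sym (rank-injective (a ∷ b ∷ x ∷ []) a x (elem-here a (b ∷ x ∷ [])) (x∈abx a b x)
                                  (trans (≡ᵇ-true⇒≡ _ 1 ra) (sym (≡ᵇ-true⇒≡ _ 1 rx)))))
             (sym (rank-injective (a ∷ b ∷ x ∷ []) b x (elem-∷ b a (b ∷ x ∷ []) (elem-here b (x ∷ []))) (x∈abx a b x)
                                  (trans (≡ᵇ-true⇒≡ _ 1 rb) (sym (≡ᵇ-true⇒≡ _ 1 rx)))))
             (==-refl (x ∷ x ∷ []))

  standardize-111-backward : ∀ a b x → ((a ≡ᵇ x) ∧ ((b ≡ᵇ x) ∧ true)) ≡ true →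
    (standardize (a ∷ b ∷ x ∷ []) == v111) ≡ true
  standardize-111-backward a b x h
    with (ea , h₁) ← ∧-true (a ≡ᵇ x) _ h
    with (eb , _)  ← ∧-true (b ≡ᵇ x) _ h₁ =
    subst₂ (λ a b → (standardize (a ∷ b ∷ x ∷ []) == v111) ≡ true)
           (sym (≡ᵇ-true⇒≡ a x ea)) (sym (≡ᵇ-true⇒≡ b x eb))
           (cong (λ r → (r ≡ᵇ 1) ∧ ((r ≡ᵇ 1) ∧ ((r ≡ᵇ 1) ∧ true))) (rank-xxx x))

  standardize-111-mismatch : ∀ u x → suc (length u) ≢ 3 → length u ≢ 2 →
    (standardize (u ∷ʳ x) == v111) ≡ (u == (x ∷ x ∷ []))
  standardize-111-mismatch u x ≢3 ≢2 =
    trans (standardize-∷ʳ-==-length u x _ ≢3) (sym (==-length u (x ∷ x ∷ []) ≢2))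

  standardize-111 : ∀ u x → (standardize (u ∷ʳ x) == v111) ≡ (u == (x ∷ x ∷ []))
  standardize-111 (a ∷ b ∷ []) x = ⇔→≡ (mk⇔ (standardize-111-forward a b x) (standardize-111-backward a b x))
  standardize-111 []              x = standardize-111-mismatch [] x (λ ()) (λ ())
  standardize-111 (a ∷ [])        x = standardize-111-mismatch (a ∷ []) x (λ ()) (λ ())
  standardize-111 (a ∷ b ∷ c ∷ u) x = standardize-111-mismatch (a ∷ b ∷ c ∷ u) x (λ ()) (λ ())

  distinct-xbbx : ∀ x b → x < b → distinct (x ∷ b ∷ b ∷ x ∷ []) ≡ b ∷ x ∷ []
  distinct-xbbx x b x<b
    rewrite distinct-∷-∈ x (b ∷ b ∷ x ∷ []) (elem-∷ x b (b ∷ x ∷ []) (elem-∷ x b (x ∷ []) (elem-here x [])))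
          | distinct-∷-∈ b (b ∷ x ∷ []) (elem-here b (x ∷ []))
          | distinct-∷-∉ b (x ∷ []) (¬T⇒≡false (λ t → <-irrefl (sym (≡ᵇ⇒≡ b x (subst T (∨-identityʳ _) t))) x<b))
    = refl

  rank-xbbx : ∀ x b → x < b → rank (x ∷ b ∷ b ∷ x ∷ []) x ≡ 1 × rank (x ∷ b ∷ b ∷ x ∷ []) b ≡ 2
  rank-xbbx x b x<b rewrite distinct-xbbx x b x<b = rank-x , rank-b
    where
    rank-x : suc (countBelow x (b ∷ x ∷ [])) ≡ 1
    rank-x rewrite ¬T⇒≡false (λ t → <-asym x<b (<ᵇ⇒< b x t)) | <ᵇ-irrefl x = refl
    rank-b : suc (countBelow b (b ∷ x ∷ [])) ≡ 2
    rank-b rewrite <ᵇ-irrefl b | T⇒≡true (<⇒<ᵇ x<b) = refl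

  standardize-1221-forward : ∀ a b c x → let r = rank (a ∷ b ∷ c ∷ x ∷ []) in
    ((r a ≡ᵇ 1) ∧ ((r b ≡ᵇ 2) ∧ ((r c ≡ᵇ 2) ∧ ((r x ≡ᵇ 1) ∧ true)))) ≡ true → isXYY x (a ∷ b ∷ c ∷ []) ≡ true
  standardize-1221-forward a b c x h
    with (ra , h₁) ← ∧-true (rank (a ∷ b ∷ c ∷ x ∷ []) a ≡ᵇ 1) _ h
    with (rb , h₂) ← ∧-true (rank (a ∷ b ∷ c ∷ x ∷ []) b ≡ᵇ 2) _ h₁
    with (rc , h₃) ← ∧-true (rank (a ∷ b ∷ c ∷ x ∷ []) c ≡ᵇ 2) _ h₂
    with (rx , _)  ← ∧-true (rank (a ∷ b ∷ c ∷ x ∷ []) x ≡ᵇ 1) _ h₃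
    = subst₂ (λ a c → isXYY x (a ∷ b ∷ c ∷ []) ≡ true)
             (sym (rank-injective W a x a∈ x∈ (trans (≡ᵇ-true⇒≡ _ 1 ra) (sym (≡ᵇ-true⇒≡ _ 1 rx)))))
             (rank-injective W b c b∈ c∈ (trans (≡ᵇ-true⇒≡ _ 2 rb) (sym (≡ᵇ-true⇒≡ _ 2 rc))))
             (trans (cong₂ (λ p q → p ∧ (q ∧ (x <ᵇ b))) (≡ᵇ-refl x) (≡ᵇ-refl b)) (T⇒≡true (<⇒<ᵇ x<b)))
    where
    W : Word
    W = a ∷ b ∷ c ∷ x ∷ []
    a∈ : elemᵇ a W ≡ true
    a∈ = elem-here a (b ∷ c ∷ x ∷ [])
    b∈ : elemᵇ b W ≡ true
    b∈ = elem-∷ b a (b ∷ c ∷ x ∷ []) (elem-here b (c ∷ x ∷ []))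
    c∈ : elemᵇ c W ≡ true
    c∈ = elem-∷ c a (b ∷ c ∷ x ∷ []) (elem-∷ c b (c ∷ x ∷ []) (elem-here c (x ∷ [])))
    x∈ : elemᵇ x W ≡ true
    x∈ = elem-∷ x a (b ∷ c ∷ x ∷ []) (elem-∷ x b (c ∷ x ∷ []) (elem-∷ x c (x ∷ []) (elem-here x [])))
    x<b : x < b
    x<b with m≤n⇒m<n∨m≡n (rank≡1⇒≤ W x (≡ᵇ-true⇒≡ _ 1 rx) b b∈)
    ... | inj₁ x<b = x<b
    ... | inj₂ x≡b =
      ⊥-elim (1≢2 (trans (sym (≡ᵇ-true⇒≡ _ 1 rx)) (trans (cong (rank W) x≡b) (≡ᵇ-true⇒≡ _ 2 rb))))
      where
      1≢2 : 1 ≢ 2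
      1≢2 ()

  standardize-1221-backward : ∀ a b c x → isXYY x (a ∷ b ∷ c ∷ []) ≡ true →
    (standardize (a ∷ b ∷ c ∷ x ∷ []) == v1221) ≡ true
  standardize-1221-backward a b c x h
    with (ea , h₁) ← ∧-true (a ≡ᵇ x) _ h
    with (ebc , x<b) ← ∧-true (b ≡ᵇ c) _ h₁
    with (rx , rb) ← rank-xbbx x b (<ᵇ⇒< x b (≡true⇒T x<b))
    = subst₂ (λ a c → (standardize (a ∷ b ∷ c ∷ x ∷ []) == v1221) ≡ true)
             (sym (≡ᵇ-true⇒≡ a x ea)) (≡ᵇ-true⇒≡ b c ebc)
             (cong₂ (λ r s → (r ≡ᵇ 1) ∧ ((s ≡ᵇ 2) ∧ ((s ≡ᵇ 2) ∧ ((r ≡ᵇ 1) ∧ true)))) rx rb)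

  standardize-1221 : ∀ u x → (standardize (u ∷ʳ x) == v1221) ≡ isXYY x u
  standardize-1221 (a ∷ b ∷ c ∷ []) x =
    ⇔→≡ (mk⇔ (standardize-1221-forward a b c x) (standardize-1221-backward a b c x))
  standardize-1221 []                  x = standardize-∷ʳ-==-length [] x v1221 (λ ())
  standardize-1221 (a ∷ [])            x = standardize-∷ʳ-==-length (a ∷ []) x v1221 (λ ())
  standardize-1221 (a ∷ b ∷ [])        x = standardize-∷ʳ-==-length (a ∷ b ∷ []) x v1221 (λ ())
  standardize-1221 (a ∷ b ∷ c ∷ d ∷ u) x = standardize-∷ʳ-==-length (a ∷ b ∷ c ∷ d ∷ u) x v1221 (λ ())


module PatternAvoidingRGF where

  open Subwords
  open Standardization using (standardize-111; standardize-1221)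
  open import Data.Nat using (_+_; _≤ᵇ_; _⊔_)
  open import Data.Nat.Properties using (⊔-assoc; ⊔-identityʳ; +-assoc; +-identityʳ)
  open import Data.Bool using (Bool; true; _∧_; _∨_; not)
  open import Data.Bool.Properties using (∨-∧-booleanAlgebra)
  open import Algebra.Lattice.Properties.BooleanAlgebra ∨-∧-booleanAlgebra using (deMorgan₂)
  open import Data.Bool.Solver using (module ∨-∧-Solver)
  open ∨-∧-Solver using (solve; _:=_) renaming (_:*_ to _:∧_)
  open import Data.List using (List; []; _∷_; _++_; _∷ʳ_; reverse)
  open import Data.List.Properties using (++-assoc; ++-identityʳ; unfold-reverse)
  open import Data.Product using (proj₁)
  open import Relation.Binary.PropositionalEquality

  good : Word → Bool
  good w = isRGF w ∧ (avoids w v111 ∧ avoids w v1221)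

  avoids-∷ʳ-111 : ∀ p x → avoids (p ∷ʳ x) v111 ≡ avoids p v111 ∧ not (twice x p)
  avoids-∷ʳ-111 p x = trans (cong not (trans (anySubword-∷ʳ _ p x)
    (cong (contains p v111 ∨_) (any-cong (subwords p) (λ u → standardize-111 u x)))))
    (deMorgan₂ (contains p v111) _)

  avoids-∷ʳ-1221 : ∀ p x → avoids (p ∷ʳ x) v1221 ≡ avoids p v1221 ∧ not (hasXYY x p)
  avoids-∷ʳ-1221 p x = trans (cong not (trans (anySubword-∷ʳ _ p x)
    (cong (contains p v1221 ∨_) (any-cong (subwords p) (λ u → standardize-1221 u x)))))
    (deMorgan₂ (contains p v1221) _)

  maxL-++ : ∀ p q → maxL (p ++ q) ≡ maxL p ⊔ maxL q
  maxL-++ []      q = refl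
  maxL-++ (y ∷ p) q = trans (cong (y ⊔_) (maxL-++ p q)) (sym (⊔-assoc y (maxL p) (maxL q)))

  isRGFFrom-++ : ∀ m p q → isRGFFrom m (p ++ q) ≡ isRGFFrom m p ∧ isRGFFrom (m ⊔ maxL p) q
  isRGFFrom-++ m []      q = cong (λ k → isRGFFrom k q) (sym (⊔-identityʳ m))
  isRGFFrom-++ m (y ∷ p) q = begin
    (1 ≤ᵇ y) ∧ ((y ≤ᵇ suc m) ∧ isRGFFrom (m ⊔ y) (p ++ q))
      ≡⟨ cong (λ t → (1 ≤ᵇ y) ∧ ((y ≤ᵇ suc m) ∧ t)) (isRGFFrom-++ (m ⊔ y) p q) ⟩
    (1 ≤ᵇ y) ∧ ((y ≤ᵇ suc m) ∧ (isRGFFrom (m ⊔ y) p ∧ isRGFFrom (m ⊔ y ⊔ maxL p) q))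
      ≡⟨ cong (λ k → (1 ≤ᵇ y) ∧ ((y ≤ᵇ suc m) ∧ (isRGFFrom (m ⊔ y) p ∧ isRGFFrom k q))) (⊔-assoc m y (maxL p)) ⟩
    (1 ≤ᵇ y) ∧ ((y ≤ᵇ suc m) ∧ (isRGFFrom (m ⊔ y) p ∧ isRGFFrom (m ⊔ (y ⊔ maxL p)) q))
      ≡⟨ solve 4 (λ a b c d → a :∧ (b :∧ (c :∧ d)) := (a :∧ (b :∧ c)) :∧ d) refl
               (1 ≤ᵇ y) (y ≤ᵇ suc m) (isRGFFrom (m ⊔ y) p) (isRGFFrom (m ⊔ (y ⊔ maxL p)) q) ⟩
    ((1 ≤ᵇ y) ∧ ((y ≤ᵇ suc m) ∧ isRGFFrom (m ⊔ y) p)) ∧ isRGFFrom (m ⊔ (y ⊔ maxL p)) q ∎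
    where open ≡-Reasoning

  good-∷ʳ : ∀ p x → good (p ∷ʳ x) ≡
    good p ∧ (((1 ≤ᵇ x) ∧ ((x ≤ᵇ suc (maxL p)) ∧ true)) ∧ (not (twice x p) ∧ not (hasXYY x p)))
  good-∷ʳ p x = trans (cong₂ _∧_ (isRGFFrom-++ 0 p (x ∷ [])) (cong₂ _∧_ (avoids-∷ʳ-111 p x) (avoids-∷ʳ-1221 p x)))
    (solve 6 (λ I r A t B u → (I :∧ r) :∧ ((A :∧ t) :∧ (B :∧ u)) := (I :∧ (A :∧ B)) :∧ (r :∧ (t :∧ u))) refl
      (isRGF p) _ (avoids p v111) _ (avoids p v1221) _)

  good-prefix : ∀ p w → good (p ++ w) ≡ true → good p ≡ true
  good-prefix p []      g = trans (cong good (sym (++-identityʳ p))) g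
  good-prefix p (x ∷ w) g = proj₁ (∧-true (good p) _ (trans (sym (good-∷ʳ p x))
    (good-prefix (p ∷ʳ x) w (trans (cong good (++-assoc p (x ∷ []) w)) g))))

  lbAux-++ : ∀ acc p q → lbAux acc (p ++ q) ≡ lbAux acc p + lbAux (reverse p ++ acc) q
  lbAux-++ acc []      q = refl
  lbAux-++ acc (x ∷ p) q = begin
    lbAt acc x + lbAux (x ∷ acc) (p ++ q)
      ≡⟨ cong (lbAt acc x +_) (lbAux-++ (x ∷ acc) p q) ⟩
    lbAt acc x + (lbAux (x ∷ acc) p + lbAux (reverse p ++ x ∷ acc) q)
      ≡⟨ cong (λ l → lbAt acc x + (lbAux (x ∷ acc) p + lbAux l q))
              (trans (sym (++-assoc (reverse p) (x ∷ []) acc)) (cong (_++ acc) (sym (unfold-reverse x p)))) ⟩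
    lbAt acc x + (lbAux (x ∷ acc) p + lbAux (reverse (x ∷ p) ++ acc) q)
      ≡⟨ sym (+-assoc (lbAt acc x) _ _) ⟩
    lbAt acc x + lbAux (x ∷ acc) p + lbAux (reverse (x ∷ p) ++ acc) q ∎
    where open ≡-Reasoning

  lb-∷ʳ : ∀ p x → lb (p ∷ʳ x) ≡ lb p + lbAt (reverse p) x
  lb-∷ʳ p x = trans (lbAux-++ [] p (x ∷ []))
    (cong (lb p +_) (trans (+-identityʳ _) (cong (λ l → lbAt l x) (++-identityʳ (reverse p)))))


module PrefixState where

  open Subwords
  open PatternAvoidingRGF
  open JumpPaths using (admissible)
  open import Data.Nat using (_<_; _∸_; _<ᵇ_; _≡ᵇ_; _≤ᵇ_; _⊔_)
  open import Data.Nat.Properties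
    using (<⇒<ᵇ; <ᵇ⇒<; ≤⇒≤ᵇ; <⇒≱; ≮⇒≥; n≮0; <-≤-trans; 0∸n≡0; m≤n⇒m≤1+n; n≤1+n; n<1+n; ≤-pred;
           ⊔-identityʳ; m≤n⇒m⊔n≡n; m≥n⇒m⊔n≡m; m≤n⇒m<n∨m≡n; <-cmp; +-∸-assoc; m≤n⇒m∸n≡0; ≤-trans; <⇒≤;
           ≤-reflexive; ≡ᵇ⇒≡)
  open import Data.Bool using (Bool; true; false; _∧_; _∨_; not; if_then_else_; T; T?)
  open import Data.Bool.Properties using (∧-identityʳ; ∧-zeroʳ; ∨-identityʳ; ∨-zeroʳ)
  open import Algebra.Lattice.Properties.BooleanAlgebra Data.Bool.Properties.∨-∧-booleanAlgebra using (deMorgan₂)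
  open import Data.List using (List; []; _∷_; _∷ʳ_; length; filter; reverse)
  open import Data.List.Properties using (reverse-++)
  open import Data.Sum using (inj₁; inj₂)
  open import Relation.Binary using (tri<; tri≈; tri>)
  open import Relation.Binary.PropositionalEquality
  open import Relation.Nullary using (contradiction)
  open import Algebra.Bundles using (CommutativeMonoid)
  open import Algebra.Properties.CommutativeSemigroup
    (CommutativeMonoid.commutativeSemigroup Data.Bool.Properties.∨-commutativeMonoid)
    using () renaming (interchange to ∨-interchange)
  import Data.Bool.Properties

  inRange : ℕ → ℕ → Bool
  inRange m y = (1 ≤ᵇ y) ∧ (y ≤ᵇ m)

  -- A good word p in state (m , e): its letters are exactly 1, …, m, the letters 1, …, e
  -- can never occur again (they occur twice, or a later copy would complete a 1221),
  -- and every pair y < z of letters already occurs in this order.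
  record State (p : Word) (m e : ℕ) : Set where
    field
      good-p      : good p ≡ true
      maxL-p      : maxL p ≡ m
      e≤m         : e ≤ m
      occurs-p    : ∀ y → occurs y p ≡ inRange m y
      exhausted-p : ∀ y → (twice y p ∨ hasXYY y p) ≡ inRange e y
      ordered-p   : ∀ y z → 1 ≤ y → y < z → z ≤ m → occurs₂ y z p ≡ true
      distinct-p  : ∀ y → elemᵇ y (distinct (reverse p)) ≡ inRange m y
      lbAt-p      : ∀ y → lbAt (reverse p) y ≡ m ∸ y

  inRange-0 : ∀ y → inRange 0 y ≡ false
  inRange-0 zero    = refl
  inRange-0 (suc y) = refl

  <ᵇ-∨-≡ᵇ : ∀ y m → ((y <ᵇ m) ∨ (m ≡ᵇ y)) ≡ (y <ᵇ suc m)
  <ᵇ-∨-≡ᵇ zero    zero    = refl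
  <ᵇ-∨-≡ᵇ zero    (suc m) = refl
  <ᵇ-∨-≡ᵇ (suc y) zero    = refl
  <ᵇ-∨-≡ᵇ (suc y) (suc m) = <ᵇ-∨-≡ᵇ y m

  ≡ᵇ-∨-<ᵇ : ∀ y m → ((y ≡ᵇ m) ∨ (y <ᵇ m)) ≡ (y <ᵇ suc m)
  ≡ᵇ-∨-<ᵇ zero    zero    = refl
  ≡ᵇ-∨-<ᵇ zero    (suc m) = refl
  ≡ᵇ-∨-<ᵇ (suc y) zero    = refl
  ≡ᵇ-∨-<ᵇ (suc y) (suc m) = ≡ᵇ-∨-<ᵇ y m

  inRange-true : ∀ {y m} → 1 ≤ y → y ≤ m → inRange m y ≡ true
  inRange-true {suc y} _ y≤m = T⇒≡true (≤⇒≤ᵇ y≤m)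

  <ᵇ-false : ∀ {a b} → b ≤ a → (a <ᵇ b) ≡ false
  <ᵇ-false {a} {b} b≤a = ¬T⇒≡false (λ t → <⇒≱ (<ᵇ⇒< a b t) b≤a)

  countAbove : ℕ → List ℕ → ℕ
  countAbove y D = length (filter (λ z → T? (y <ᵇ z)) D)

  countAbove-∷ : ∀ y d D → countAbove y (d ∷ D) ≡ (if y <ᵇ d then suc (countAbove y D) else countAbove y D)
  countAbove-∷ y d D with y <ᵇ d
  ... | true  = refl
  ... | false = refl

  state-[] : State [] 0 0
  state-[] = record
    { good-p = refl ; maxL-p = refl ; e≤m = z≤n
    ; occurs-p = λ y → sym (inRange-0 y)
    ; exhausted-p = λ y → sym (inRange-0 y)
    ; ordered-p = λ y z _ y<z z≤0 → ⊥-elim (n≮0 (<-≤-trans y<z z≤0))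
    ; distinct-p = λ y → sym (inRange-0 y)
    ; lbAt-p = λ y → sym (0∸n≡0 y) }

  good-∷ʳ-state : ∀ {p m e} → State p m e → ∀ a → good (p ∷ʳ suc a) ≡ admissible m e a
  good-∷ʳ-state {p} {m} {e} S a = begin
    good (p ∷ʳ suc a)
      ≡⟨ good-∷ʳ p (suc a) ⟩
    good p ∧ ((true ∧ ((suc a ≤ᵇ suc (maxL p)) ∧ true)) ∧ (not (twice (suc a) p) ∧ not (hasXYY (suc a) p)))
      ≡⟨ cong₂ (λ g k → g ∧ ((true ∧ ((suc a ≤ᵇ suc k) ∧ true)) ∧ (not (twice (suc a) p) ∧ not (hasXYY (suc a) p))))
               (State.good-p S) (State.maxL-p S) ⟩
    ((a <ᵇ suc m) ∧ true) ∧ (not (twice (suc a) p) ∧ not (hasXYY (suc a) p))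
      ≡⟨ cong₂ _∧_ (∧-identityʳ (a <ᵇ suc m))
               (trans (sym (deMorgan₂ (twice (suc a) p) (hasXYY (suc a) p))) (cong not (State.exhausted-p S (suc a)))) ⟩
    admissible m e a ∎
    where open ≡-Reasoning

  state-new : ∀ {p m e} → State p m e → State (p ∷ʳ suc m) (suc m) e
  state-new {p} {m} {e} S = record
    { good-p      = trans (good-∷ʳ-state S m)
                          (cong₂ (λ s t → s ∧ not t) (T⇒≡true (<⇒<ᵇ (n<1+n m))) (<ᵇ-false (State.e≤m S)))
    ; maxL-p      = trans (maxL-++ p (x ∷ [])) (trans (cong (_⊔ (x ⊔ 0)) (State.maxL-p S))
                          (trans (cong (m ⊔_) (⊔-identityʳ x)) (m≤n⇒m⊔n≡n (n≤1+n m))))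
    ; e≤m         = m≤n⇒m≤1+n (State.e≤m S)
    ; occurs-p    = occurs-p′
    ; exhausted-p = exhausted-p′
    ; ordered-p   = ordered-p′
    ; distinct-p  = distinct-p′
    ; lbAt-p      = lbAt-p′
    }
    where
    x : ℕ
    x = suc m
    x-new : occurs x p ≡ false
    x-new = trans (State.occurs-p S x) (<ᵇ-irrefl m)
    occurs-p′ : ∀ y → occurs y (p ∷ʳ x) ≡ inRange x y
    occurs-p′ zero    = trans (occurs-∷ʳ zero p x) (cong (_∨ false) (State.occurs-p S zero))
    occurs-p′ (suc y) =
      trans (occurs-∷ʳ (suc y) p x) (trans (cong (_∨ (m ≡ᵇ y)) (State.occurs-p S (suc y))) (<ᵇ-∨-≡ᵇ y m))
    no-pair₁ : ∀ y → (occurs y p ∧ (x ≡ᵇ y)) ≡ false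
    no-pair₁ y with x ≡ᵇ y in x≡y
    ... | true rewrite sym (≡ᵇ-true⇒≡ x y x≡y) = trans (∧-identityʳ _) x-new
    ... | false = ∧-zeroʳ _
    no-pair₂ : ∀ y → ((y <ᵇ x) ∧ occurs₂ y x p) ≡ false
    no-pair₂ y with occurs₂ y x p in yx
    ... | true  = contradiction (trans (sym x-new) (occurs₂⇒occursʳ y x p yx)) (λ ())
    ... | false = ∧-zeroʳ _
    exhausted-p′ : ∀ y → (twice y (p ∷ʳ x) ∨ hasXYY y (p ∷ʳ x)) ≡ inRange e y
    exhausted-p′ y = trans
      (cong₂ _∨_ (trans (occurs₂-∷ʳ y y p x) (trans (cong (twice y p ∨_) (no-pair₁ y)) (∨-identityʳ _)))
                 (trans (hasXYY-∷ʳ y p x) (trans (cong (hasXYY y p ∨_) (no-pair₂ y)) (∨-identityʳ _))))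
      (State.exhausted-p S y)
    ordered-p′ : ∀ y z → 1 ≤ y → y < z → z ≤ x → occurs₂ y z (p ∷ʳ x) ≡ true
    ordered-p′ y z 1≤y y<z z≤x with m≤n⇒m<n∨m≡n z≤x
    ... | inj₁ (s≤s z≤m) =
      trans (occurs₂-∷ʳ y z p x) (cong (_∨ (occurs y p ∧ (x ≡ᵇ z))) (State.ordered-p S y z 1≤y y<z z≤m))
    ... | inj₂ refl = trans (occurs₂-∷ʳ y x p x) (trans (cong (occurs₂ y x p ∨_)
      (cong₂ _∧_ (trans (State.occurs-p S y) (inRange-true 1≤y (≤-pred y<z))) (≡ᵇ-refl x))) (∨-zeroʳ _))
    D : List ℕ
    D = distinct (reverse p)
    distinct-new : distinct (reverse (p ∷ʳ x)) ≡ x ∷ D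
    distinct-new = trans (cong distinct (reverse-++ p (x ∷ [])))
                         (cong (λ b → if b then D else x ∷ D) (trans (State.distinct-p S x) (<ᵇ-irrefl m)))
    distinct-p′ : ∀ y → elemᵇ y (distinct (reverse (p ∷ʳ x))) ≡ inRange x y
    distinct-p′ y rewrite distinct-new with y
    ... | zero   = cong (false ∨_) (State.distinct-p S zero)
    ... | suc y′ = trans (cong ((y′ ≡ᵇ m) ∨_) (State.distinct-p S (suc y′))) (≡ᵇ-∨-<ᵇ y′ m)
    lbAt-p′ : ∀ y → lbAt (reverse (p ∷ʳ x)) y ≡ x ∸ y
    lbAt-p′ y = trans (cong (countAbove y) distinct-new) (trans (countAbove-∷ y x D) count)
      where
      count : (if y <ᵇ x then suc (countAbove y D) else countAbove y D) ≡ x ∸ y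
      count with y <ᵇ x in y<x
      ... | true  = trans (cong suc (State.lbAt-p S y)) (sym (+-∸-assoc 1 (≤-pred (<ᵇ⇒< y x (≡true⇒T y<x)))))
      ... | false = trans (State.lbAt-p S y) (trans (m≤n⇒m∸n≡0 (≤-trans (n≤1+n m) x≤y)) (sym (m≤n⇒m∸n≡0 x≤y)))
        where
        x≤y : x ≤ y
        x≤y = ≮⇒≥ (λ y<x′ → subst T y<x (<⇒<ᵇ y<x′))

  state-repeat : ∀ {p m e} → State p m e → ∀ a → e ≤ a → a < m → State (p ∷ʳ suc a) m (suc a)
  state-repeat {p} {m} {e} S a e≤a a<m = record
    { good-p      = trans (good-∷ʳ-state S a)
                          (cong₂ (λ s t → s ∧ not t) (T⇒≡true (<⇒<ᵇ (m≤n⇒m≤1+n a<m))) (<ᵇ-false e≤a))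
    ; maxL-p      = trans (maxL-++ p (x ∷ [])) (trans (cong (_⊔ (x ⊔ 0)) (State.maxL-p S))
                          (trans (cong (m ⊔_) (⊔-identityʳ x)) (m≥n⇒m⊔n≡m a<m)))
    ; e≤m         = a<m
    ; occurs-p    = occurs-p′
    ; exhausted-p = exhausted-p′
    ; ordered-p   = λ y z 1≤y y<z z≤m →
                      trans (occurs₂-∷ʳ y z p x) (cong (_∨ (occurs y p ∧ (x ≡ᵇ z))) (State.ordered-p S y z 1≤y y<z z≤m))
    ; distinct-p  = λ y → trans (cong (elemᵇ y) distinct-same) (State.distinct-p S y)
    ; lbAt-p      = λ y → trans (cong (countAbove y) distinct-same) (State.lbAt-p S y)
    }
    where
    x : ℕ
    x = suc a
    x-old : inRange m x ≡ true
    x-old = inRange-true (s≤s z≤n) a<m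
    distinct-same : distinct (reverse (p ∷ʳ x)) ≡ distinct (reverse p)
    distinct-same = trans (cong distinct (reverse-++ p (x ∷ [])))
                          (cong (λ b → if b then distinct (reverse p) else x ∷ distinct (reverse p))
                                (trans (State.distinct-p S x) x-old))
    occurs-p′ : ∀ y → occurs y (p ∷ʳ x) ≡ inRange m y
    occurs-p′ y with x ≡ᵇ y in x≡y
    ... | true rewrite sym (≡ᵇ-true⇒≡ x y x≡y) =
      trans (occurs-∷ʳ x p x) (trans (cong (occurs x p ∨_) (≡ᵇ-refl x)) (trans (∨-zeroʳ _) (sym x-old)))
    ... | false =
      trans (occurs-∷ʳ y p x) (trans (cong (occurs y p ∨_) x≡y) (trans (∨-identityʳ _) (State.occurs-p S y)))
    -- Repeating x exhausts x itself and, through the pairs y x with y < x, every smaller letter.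
    exhausted : ∀ y → (inRange e y ∨ ((inRange m y ∧ (x ≡ᵇ y)) ∨ ((y <ᵇ x) ∧ occurs₂ y x p))) ≡ inRange x y
    exhausted zero with occurs₂ zero x p in 0x
    ... | true  = contradiction (trans (sym (State.occurs-p S zero)) (occurs₂⇒occursˡ zero x p 0x)) (λ ())
    ... | false = refl
    exhausted (suc y) with <-cmp y a
    ... | tri< y<a _ _
      rewrite T⇒≡true (<⇒<ᵇ y<a) | State.ordered-p S (suc y) x (s≤s z≤n) (s≤s y<a) a<m
            | T⇒≡true (<⇒<ᵇ (m≤n⇒m≤1+n y<a)) = trans (cong ((y <ᵇ e) ∨_) (∨-zeroʳ _)) (∨-zeroʳ _)
    ... | tri≈ _ refl _ rewrite ≡ᵇ-refl y | T⇒≡true (<⇒<ᵇ a<m) | T⇒≡true (<⇒<ᵇ (n<1+n y)) = ∨-zeroʳ _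
    ... | tri> _ _ a<y
      rewrite <ᵇ-false {y} {e} (≤-trans e≤a (<⇒≤ a<y))
            | ¬T⇒≡false (λ t → <⇒≱ a<y (≤-reflexive (sym (≡ᵇ⇒≡ a y t))))
            | <ᵇ-false {y} {a} (<⇒≤ a<y) | <ᵇ-false {y} {suc a} a<y = cong (_∨ false) (∧-zeroʳ _)
    exhausted-p′ : ∀ y → (twice y (p ∷ʳ x) ∨ hasXYY y (p ∷ʳ x)) ≡ inRange x y
    exhausted-p′ y = trans (cong₂ _∨_ (occurs₂-∷ʳ y y p x) (hasXYY-∷ʳ y p x))
      (trans (∨-interchange (twice y p) (occurs y p ∧ (x ≡ᵇ y)) (hasXYY y p) ((y <ᵇ x) ∧ occurs₂ y x p))
      (trans (cong₂ (λ s t → s ∨ ((t ∧ (x ≡ᵇ y)) ∨ ((y <ᵇ x) ∧ occurs₂ y x p)))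
                    (State.exhausted-p S y) (State.occurs-p S y))
             (exhausted y)))


module Enumeration where

  open QPolynomial
  open JumpPaths using (admissible; continuations; continuationsBy)
  open PatternAvoidingRGF
  open PrefixState
  open import Data.Nat using (_+_; _∸_; _<_; _≡ᵇ_; _<ᵇ_)
  open import Data.Nat.Properties
    using (+-identityʳ; ≮⇒≥; <ᵇ⇒<; <⇒<ᵇ; ≤-pred; m≤n⇒m<n∨m≡n; ≡⇒≡ᵇ; m≤n⇒m∸n≡0; n≤1+n)
  open import Data.Product using (_×_; _,_)
  open import Data.Nat.ListAction using (sum)
  open import Data.Nat.ListAction.Properties using (sum-++)
  open import Data.Bool using (Bool; true; false; _∧_; not; if_then_else_; T)
  open import Data.Bool.Properties using (not-involutive)
  open import Data.List using (List; []; _∷_; map; _++_; _∷ʳ_; length; filter; concatMap)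
  open import Data.List.Base using (upTo)
  open import Data.List.Properties using (map-++; ++-assoc; ++-identityʳ; map-∘)
  open import Data.Sum using (inj₁; inj₂)
  open import Relation.Nullary using (does; contradiction)
  open import Relation.Unary using (Decidable)
  open import Algebra.Properties.CommutativeSemigroup Data.Nat.Properties.+-commutativeSemigroup using (interchange)
  open import Relation.Binary.PropositionalEquality

  sum-map-cong : ∀ {A : Set} {f g : A → ℕ} xs → (∀ x → f x ≡ g x) → sum (map f xs) ≡ sum (map g xs)
  sum-map-cong []       e = refl
  sum-map-cong (x ∷ xs) e = cong₂ _+_ (e x) (sum-map-cong xs e)

  sum-map-0 : ∀ {A : Set} (xs : List A) → sum (map (λ _ → 0) xs) ≡ 0
  sum-map-0 []       = refl
  sum-map-0 (x ∷ xs) = sum-map-0 xs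

  sum-map-+ : ∀ {A : Set} (f g : A → ℕ) xs → sum (map (λ x → f x + g x) xs) ≡ sum (map f xs) + sum (map g xs)
  sum-map-+ f g []       = refl
  sum-map-+ f g (x ∷ xs) = trans (cong (f x + g x +_) (sum-map-+ f g xs)) (interchange (f x) (g x) _ _)

  sum-map-concatMap : ∀ {A B : Set} (f : B → ℕ) (g : A → List B) xs →
    sum (map f (concatMap g xs)) ≡ sum (map (λ x → sum (map f (g x))) xs)
  sum-map-concatMap f g []       = refl
  sum-map-concatMap f g (x ∷ xs) = trans (cong sum (map-++ f (g x) (concatMap g xs)))
    (trans (sum-++ (map f (g x)) (map f (concatMap g xs))) (cong (sum (map f (g x)) +_) (sum-map-concatMap f g xs)))

  sum-map-swap : ∀ {A B : Set} (h : A → B → ℕ) (as : List A) (bs : List B) →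
    sum (map (λ b → sum (map (λ a → h a b) as)) bs) ≡ sum (map (λ a → sum (map (h a) bs)) as)
  sum-map-swap h as []       = sym (sum-map-0 as)
  sum-map-swap h as (b ∷ bs) = trans (cong (sum (map (λ a → h a b) as) +_) (sum-map-swap h as bs))
    (sym (sum-map-+ (λ a → h a b) (λ a → sum (map (h a) bs)) as))

  length-filter³ : ∀ {P Q R : Word → Set} (P? : Decidable P) (Q? : Decidable Q) (R? : Decidable R) xs →
    length (filter R? (filter Q? (filter P? xs))) ≡
    sum (map (λ w → if (does (P? w) ∧ does (Q? w)) ∧ does (R? w) then 1 else 0) xs)
  length-filter³ P? Q? R? [] = refl
  length-filter³ P? Q? R? (x ∷ xs) with does (P? x)
  ... | false = length-filter³ P? Q? R? xs
  ... | true with does (Q? x)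
  ...   | false = length-filter³ P? Q? R? xs
  ...   | true with does (R? x)
  ...     | true  = cong suc (length-filter³ P? Q? R? xs)
  ...     | false = length-filter³ P? Q? R? xs

  indicator : Word → Poly
  indicator w d = if good w ∧ (lb w ≡ᵇ d) then 1 else 0

  goodExtensions : ℕ → Word → ℕ → Poly
  goodExtensions k p n d = sum (map (λ w → indicator (p ++ w) d) (wordsOver k n))

  LB≗goodExtensions : ∀ n → LB n v111 v1221 ≗ goodExtensions n [] n
  LB≗goodExtensions n d = length-filter³ _ _ _ (wordsOver n n)

  goodExtensions-suc : ∀ k p n → goodExtensions k p (suc n) ≗ Σ< k (λ a → goodExtensions k (p ∷ʳ suc a) n)
  goodExtensions-suc k p n d = begin
    sum (map (λ w → indicator (p ++ w) d) (concatMap (λ w → map (λ a → suc a ∷ w) (upTo k)) (wordsOver k n)))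
      ≡⟨ sum-map-concatMap (λ w → indicator (p ++ w) d) (λ w → map (λ a → suc a ∷ w) (upTo k)) (wordsOver k n) ⟩
    sum (map (λ w → sum (map (λ w′ → indicator (p ++ w′) d) (map (λ a → suc a ∷ w) (upTo k)))) (wordsOver k n))
      ≡⟨ sum-map-cong (wordsOver k n) (λ w → cong sum (sym (map-∘ (upTo k)))) ⟩
    sum (map (λ w → sum (map (λ a → indicator (p ++ suc a ∷ w) d) (upTo k))) (wordsOver k n))
      ≡⟨ sum-map-swap (λ a w → indicator (p ++ suc a ∷ w) d) (upTo k) (wordsOver k n) ⟩
    sum (map (λ a → sum (map (λ w → indicator (p ++ suc a ∷ w) d) (wordsOver k n))) (upTo k))
      ≡⟨ sum-map-cong (upTo k) (λ a → sum-map-cong (wordsOver k n)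
           (λ w → cong (λ l → indicator l d) (sym (++-assoc p (suc a ∷ []) w)))) ⟩
    sum (map (λ a → goodExtensions k (p ∷ʳ suc a) n d) (upTo k))
      ≡⟨ sum-upTo≡Σ< k (λ a → goodExtensions k (p ∷ʳ suc a) n) d ⟩
    Σ< k (λ a → goodExtensions k (p ∷ʳ suc a) n) d ∎
    where open ≡-Reasoning

  goodExtensions-bad : ∀ k p n → good p ≡ false → goodExtensions k p n ≗ 0ₚ
  goodExtensions-bad k p n bad d = trans (sum-map-cong (wordsOver k n) vanish) (sum-map-0 (wordsOver k n))
    where
    vanish : ∀ w → indicator (p ++ w) d ≡ 0
    vanish w with good (p ++ w) in g
    ... | true  = contradiction (trans (sym bad) (good-prefix p w g)) (λ ())
    ... | false = refl

  indicator≡monomial : ∀ ℓ d → (if ℓ ≡ᵇ d then 1 else 0) ≡ monomial ℓ d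
  indicator≡monomial zero    zero    = refl
  indicator≡monomial zero    (suc d) = refl
  indicator≡monomial (suc ℓ) zero    = refl
  indicator≡monomial (suc ℓ) (suc d) = trans (indicator≡monomial ℓ d) (sym (qpow-suc ℓ one (suc d)))

  admissible-repeat : ∀ m e a → admissible m e a ≡ true → (a ≡ᵇ m) ≡ false → e ≤ a × a < m
  admissible-repeat m e a adm a≢m with (a<1+m , a≮e) ← ∧-true (a <ᵇ suc m) _ adm =
    ≮⇒≥ (λ a<e → subst T (trans (sym (not-involutive (a <ᵇ e))) (cong not a≮e)) (<⇒<ᵇ a<e)) , a<m
    where
    a<m : a < m
    a<m with m≤n⇒m<n∨m≡n (≤-pred (<ᵇ⇒< a (suc m) (≡true⇒T a<1+m)))
    ... | inj₁ a<m = a<m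
    ... | inj₂ a≡m = contradiction (trans (sym a≢m) (T⇒≡true (≡⇒≡ᵇ a m a≡m))) (λ ())

  goodExtensions≗continuations : ∀ n k {p m e} → State p m e →
    goodExtensions k p n ≗ (qpow· (lb p)) (continuations k m e n)
  goodExtensions≗continuations zero k {p} S d =
    trans (+-identityʳ _) (trans (cong (λ l → indicator l d) (++-identityʳ p))
          (trans (cong (λ g → if g ∧ (lb p ≡ᵇ d) then 1 else 0) (State.good-p S)) (indicator≡monomial (lb p) d)))
  goodExtensions≗continuations (suc n) k {p} {m} {e} S d =
    trans (goodExtensions-suc k p n d)
          (trans (Σ<-cong k step d) (sym (qpow-Σ< (lb p) k (continuationsBy k m e n) d)))
    where
    step : ∀ a → goodExtensions k (p ∷ʳ suc a) n ≗ (qpow· (lb p)) (continuationsBy k m e n a)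
    step a d′ with admissible m e a in adm
    ... | false = trans (goodExtensions-bad k (p ∷ʳ suc a) n (trans (good-∷ʳ-state S a) adm) d′)
                        (sym (qpow-0ₚ (lb p) d′))
    ... | true with a ≡ᵇ m in a≡m
    ...   | true rewrite ≡ᵇ-true⇒≡ a m a≡m =
            trans (goodExtensions≗continuations n k (state-new S) d′)
                  (qpow-exp (continuations k (suc m) e n) lb-new d′)
      where
      lb-new : lb (p ∷ʳ suc m) ≡ lb p
      lb-new = trans (lb-∷ʳ p (suc m))
                     (trans (cong (lb p +_) (trans (State.lbAt-p S (suc m)) (m≤n⇒m∸n≡0 (n≤1+n m)))) (+-identityʳ (lb p)))
    ...   | false with (e≤a , a<m) ← admissible-repeat m e a adm a≡m =
            trans (goodExtensions≗continuations n k (state-repeat S a e≤a a<m) d′)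
                  (trans (qpow-exp (continuations k m (suc a) n) (lb-∷ʳ-repeat) d′)
                         (sym (qpow-+ (lb p) (m ∸ suc a) (continuations k m (suc a) n) d′)))
      where
      lb-∷ʳ-repeat : lb (p ∷ʳ suc a) ≡ lb p + (m ∸ suc a)
      lb-∷ʳ-repeat = trans (lb-∷ʳ p (suc a)) (cong (lb p +_) (State.lbAt-p S (suc a)))

  LB≗continuations : ∀ n → LB n v111 v1221 ≗ continuations n 0 0 n
  LB≗continuations n d = trans (LB≗goodExtensions n d) (goodExtensions≗continuations n n state-[] d)


open import Relation.Binary.PropositionalEquality using (trans; sym)
open import Data.Nat.Properties using (+-identityʳ)
open QPolynomial using (⊕-cong; ⊛-cong; qpow-cong; Σ₁-cong)
open MotzkinRecurrence using (L; L-recurrence)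

LB≗L : ∀ n → LB n v111 v1221 ≗ L n
LB≗L n d = trans (Enumeration.LB≗continuations n d)
                 (trans (JumpPaths.continuations≗jump n n 0 0 z≤n ≤-refl d) (JumpPaths.jump₀≗L n d))

theorem6p10 : (LB 0 (1 ∷ 1 ∷ 1 ∷ []) (1 ∷ 2 ∷ 2 ∷ 1 ∷ []) ≗ one)
    × (LB 1 (1 ∷ 1 ∷ 1 ∷ []) (1 ∷ 2 ∷ 2 ∷ 1 ∷ []) ≗ one)
    × (∀ (m : ℕ) → LB (suc (suc m)) (1 ∷ 1 ∷ 1 ∷ []) (1 ∷ 2 ∷ 2 ∷ 1 ∷ [])
    ≗ (LB (suc m) (1 ∷ 1 ∷ 1 ∷ []) (1 ∷ 2 ∷ 2 ∷ 1 ∷ [])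
    ⊕ LB m (1 ∷ 1 ∷ 1 ∷ []) (1 ∷ 2 ∷ 2 ∷ 1 ∷ [])
    ⊕ Σ₁ m (λ k → (qpow· k) (LB (k ∸ 1) (1 ∷ 1 ∷ 1 ∷ []) (1 ∷ 2 ∷ 2 ∷ 1 ∷ [])
    ⊛ LB (suc (suc m) ∸ k ∸ 1) (1 ∷ 1 ∷ 1 ∷ []) (1 ∷ 2 ∷ 2 ∷ 1 ∷ [])))))
theorem6p10 = LB≗L 0
  , (λ d → trans (LB≗L 1 d) (trans (+-identityʳ _) (+-identityʳ _)))
  , λ m d → trans (LB≗L (suc (suc m)) d) (trans (L-recurrence m d)
      (sym (⊕-cong (⊕-cong (LB≗L (suc m)) (LB≗L m))
                   (Σ₁-cong m (λ k → qpow-cong k (⊛-cong (LB≗L (k ∸ 1)) (LB≗L (suc (suc m) ∸ k ∸ 1))))) d)))
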